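{- Let $p$ be a prime and let $[w]$ be a necklace of length $n$ over $\Sigma_p$. The following are equivalent: (1) $[w]$ is invertible, i.e. its Burrows–Wheeler matrix is nonsingular over $\mathrm{GF}_p$; (2) every word in $[w]$ has an invertible circulant matrix over $\mathrm{GF}_p$; (3) the set $\mathrm{CM}_{[w]}=\{\mathrm{CM}_v: v\in[w]\}$ is an element of the Reutenauer group $RG_p^n$; (4) for every word $v=v_0\cdots v_{n-1}\in[w]$, the element $\sum_{j=0}^{n-1}v_j\gamma^{p^j}$ of $\mathrm{GF}_{p^n}$ is normal, where $\gamma$ is a fixed normal element of $\mathrm{GF}_{p^n}$; (5) every word $x$ of length $n$ over $\Sigma_p$ can be written in a unique way as $x=\sum_{v\in[w]}c_v v \pmod p$ (componentwise) with $c_v\in\{0,\ldots,p-1\}$.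
   Context: $\Sigma_p=\{0,\ldots,p-1\}$, identified with $\mathrm{GF}_p$; words of length $n$ are identified with vectors in $\mathrm{GF}_p^n$. The shift of $w=w_0\cdots w_{n-1}$ is $\sigma(w)=w_{n-1}w_0\cdots w_{n-2}$, and the necklace $[w]$ is the set of rotations of $w$. The Burrows–Wheeler matrix of $[w]$ is the $n\times n$ matrix whose rows are the $n$ rotations $\sigma^i(w)$, $0\le i<n$ (with multiplicity), in ascending lexicographic order. The circulant matrix $\mathrm{CM}_v$ of a word $v$ of length $n$ is the $n\times n$ matrix whose $(i+1)$-th row is $\sigma^i(v)$, $0\le i<n$. $C(p,n)$ is the group (under matrix multiplication) of invertible $n\times n$ circulant matrices over $\mathrm{GF}_p$, $Q_n$ is the permutation matrix of the cycle $(0\ 1\ \cdots\ n-1)$, and the Reutenauer group is $RG_p^n=C(p,n)/\langle Q_n\rangle$, whose elements are cosets of $\langle Q_n\rangle$. An element $\gamma\in\mathrm{GF}_{p^n}$ is normal if $\{\gamma,\gamma^p,\ldots,\gamma^{p^{n-1}}\}$ is a basis of $\mathrm{GF}_{p^n}$ over $\mathrm{GF}_p$. -}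

module Defs where

open import Level using (0ℓ)
open import Data.Nat as ℕ using (ℕ; zero; suc; NonZero)
open import Data.Nat.DivMod using (_mod_)
open import Data.Fin as Fin using (Fin; toℕ; fromℕ; inject₁)
open import Data.Bool using (Bool; true; false; if_then_else_)
open import Data.Vec as Vec using (Vec; []; _∷_; lookup; removeAt; last; init; iterate; tabulate)
open import Data.Product using (Σ; ∃; _×_; _,_)
open import Relation.Nullary using (¬_; does)
open import Relation.Binary.PropositionalEquality using (_≡_)
open import Algebra.Bundles using (CommutativeRing)
open import Data.List as List using (List; deduplicate)
import Data.Vec.Properties as VecP

module _ {p : ℕ} .{{_ : NonZero p}} where

  𝟘 𝟙 : Fin p
  𝟘 = 0 mod p
  𝟙 = 1 mod p

  _+ₚ_ _*ₚ_ : Fin p → Fin p → Fin p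
  a +ₚ b = (toℕ a ℕ.+ toℕ b) mod p
  a *ₚ b = (toℕ a ℕ.* toℕ b) mod p

  -ₚ_ : Fin p → Fin p
  -ₚ a = (p ℕ.∸ toℕ a) mod p

  sumₚ : ∀ {n} → (Fin n → Fin p) → Fin p
  sumₚ {zero}  f = 𝟘
  sumₚ {suc n} f = f Fin.zero +ₚ sumₚ (λ i → f (Fin.suc i))

Word : ℕ → ℕ → Set
Word p n = Vec (Fin p) n

shift : ∀ {A : Set} {n} → Vec A n → Vec A n
shift []           = []
shift xs@(_ ∷ _)   = last xs ∷ init xs

rot : ∀ {A : Set} {n} → ℕ → Vec A n → Vec A n
rot zero    w = w
rot (suc k) w = shift (rot k w)

_∈[_] : ∀ {p n} → Word p n → Word p n → Set
_∈[_] {n = n} v w = ∃ λ (i : Fin n) → v ≡ rot (toℕ i) w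

Mat : ℕ → ℕ → Set
Mat p n = Vec (Vec (Fin p) n) n

CM : ∀ {p n} → Word p n → Mat p n
CM {n = n} v = iterate shift v n

lex≤ : ∀ {p n} → Word p n → Word p n → Bool
lex≤ []       []       = true
lex≤ (x ∷ xs) (y ∷ ys) =
  if does (x Fin.<? y) then true
  else if does (x Fin.≟ y) then lex≤ xs ys else false

insertLex : ∀ {p n m} → Word p n → Vec (Word p n) m → Vec (Word p n) (suc m)
insertLex u []       = u ∷ []
insertLex u (v ∷ vs) = if lex≤ u v then u ∷ v ∷ vs else v ∷ insertLex u vs

sortLex : ∀ {p n m} → Vec (Word p n) m → Vec (Word p n) m
sortLex []       = []
sortLex (v ∷ vs) = insertLex v (sortLex vs)

-- Burrows–Wheeler matrix of [w]: the n rotations σ^i(w) (with multiplicity)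
-- in ascending lexicographic order
BWM : ∀ {p n} → Word p n → Mat p n
BWM w = sortLex (CM w)

module _ {p : ℕ} .{{_ : NonZero p}} where

  det : ∀ {n} → Mat p n → Fin p
  det {zero}  []       = 𝟙
  det {suc n} (r ∷ rs) =
    sumₚ (λ j → sgn j *ₚ (lookup r j *ₚ det (Vec.map (λ row → removeAt row j) rs)))
    where
    sgn : Fin (suc n) → Fin p
    sgn j = if does (toℕ j mod 2 Fin.≟ Fin.zero) then 𝟙 else -ₚ 𝟙

  Nonsingular : ∀ {n} → Mat p n → Set
  Nonsingular M = ¬ (det M ≡ 𝟘)

  _·_ : ∀ {n} → Mat p n → Mat p n → Mat p n
  A · B = tabulate λ i → tabulate λ j → sumₚ (λ k → lookup (lookup A i) k *ₚ lookup (lookup B k) j)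

  I : ∀ {n} → Mat p n
  I = tabulate λ i → tabulate λ j → if does (i Fin.≟ j) then 𝟙 else 𝟘

  Invertible : ∀ {n} → Mat p n → Set
  Invertible {n} A = Σ (Mat p n) λ B → (A · B ≡ I) × (B · A ≡ I)

  _^ᴹ_ : ∀ {n} → Mat p n → ℕ → Mat p n
  A ^ᴹ zero  = I
  A ^ᴹ suc k = A · (A ^ᴹ k)

  csuc : ∀ {n} → Fin n → Fin n
  csuc {suc m} i = (suc (toℕ i)) mod (suc m)

  Q : ∀ {n} → Mat p n
  Q = tabulate λ i → tabulate λ j → if does (j Fin.≟ csuc i) then 𝟙 else 𝟘

  InC : ∀ {n} → Mat p n → Set
  InC {n} A = (∃ λ (v : Word p n) → A ≡ CM v) × Invertible A

  -- a set S of matrices (given by a predicate) is an element of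
  -- RG_p^n = C(p,n)/⟨Q_n⟩, i.e. S is a coset A⟨Q_n⟩ with A ∈ C(p,n)
  IsElemRG : ∀ {n} → (Mat p n → Set) → Set
  IsElemRG {n} S = ∃ λ (A : Mat p n) → InC A ×
    (∀ M → (S M → ∃ λ (k : ℕ) → M ≡ A · (Q ^ᴹ k)) × ((∃ λ (k : ℕ) → M ≡ A · (Q ^ᴹ k)) → S M))

  CMset : ∀ {n} → Word p n → Mat p n → Set
  CMset w M = ∃ λ v → v ∈[ w ] × M ≡ CM v

  -- componentwise linear combination Σ_{v∈[w]} c_v v  (mod p), the sum
  -- taken over the (distinct) elements of [w]
  -- (over a duplicate-free list of the rotations of w)
  necklace : ∀ {n} → Word p n → List (Word p n)
  necklace w = deduplicate (VecP.≡-dec Fin._≟_) (Vec.toList (CM w))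

  combo : ∀ {n} → (Word p n → Fin p) → Word p n → Word p n
  combo c w = List.foldr (λ v acc → Vec.zipWith _+ₚ_ (Vec.map (c v *ₚ_) v) acc)
                         (Vec.replicate _ 𝟘) (necklace w)

record IsGF (p n : ℕ) (F : CommutativeRing 0ℓ 0ℓ) : Set where
  open CommutativeRing F
  field
    nontrivial : ¬ (1# ≈ 0#)
    inverse    : ∀ x → ¬ (x ≈ 0#) → ∃ λ y → x * y ≈ 1#
    enum       : Fin (p ℕ.^ n) → Carrier
    enum-inj   : ∀ i j → enum i ≈ enum j → i ≡ j
    enum-surj  : ∀ x → ∃ λ i → enum i ≈ x

module FieldOps {p : ℕ} (F : CommutativeRing 0ℓ 0ℓ) where
  open CommutativeRing F

  pow : Carrier → ℕ → Carrier
  pow x zero    = 1#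
  pow x (suc k) = x * pow x k

  scal : Fin p → Carrier → Carrier
  scal c x = go (toℕ c)
    where
    go : ℕ → Carrier
    go zero    = 0#
    go (suc k) = x + go k

  frobComb : ∀ {n} → Carrier → Vec (Fin p) n → Carrier
  frobComb {n} γ c = go c 0
    where
    go : ∀ {m} → Vec (Fin p) m → ℕ → Carrier
    go []       j = 0#
    go (c ∷ cs) j = scal c (pow γ (p ℕ.^ j)) + go cs (suc j)

  -- γ normal: {γ, γ^p, …, γ^{p^{n-1}}} is a basis of F over GF_p, i.e. every
  -- element has exactly one coordinate vector
  Normal : ℕ → Carrier → Set
  Normal n γ = ∀ x → (∃ λ (c : Vec (Fin p) n) → frobComb γ c ≈ x)
                   × (∀ (c d : Vec (Fin p) n) → frobComb γ c ≈ x → frobComb γ d ≈ x → c ≡ d)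

{-# OPTIONS --safe #-}
-- All five conditions are equivalent to the nonsingularity of the circulant matrix CM_w over GF_p.
-- The Burrows–Wheeler matrix of [w] and every CM_v with v ∈ [w] have the same set of rows, the
-- rotations of w, and nonsingularity only depends on the set of rows: if every row of M is a row of N,
-- then the kernel of N lies in the kernel of M. Since CM_v · Q_n = CM_σ(v), the set CM_[w] is the coset
-- CM_w⟨Q_n⟩, and the word Σ c_v v is the row vector (c_v) times CM_w, so (5) says that CM_w is
-- invertible. In GF_{p^n} the Frobenius map x ↦ x^p is additive and, because x^{p^n} = x, permutes the
-- normal basis γ^{p^j} cyclically; hence β = Σ v_j γ^{p^j} satisfies Σ c_i β^{p^i} = Σ (c · CM_v)_j γ^{p^j},
-- and β is normal exactly when CM_v is nonsingular.
-- Determinants are related to invertibility by Gaussian elimination: every square matrix over GF_p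
-- either has determinant 0 and a nonzero kernel vector, or nonzero determinant and is surjective.
module Submission where

open import Defs
open import Level using (0ℓ)
open import Data.Nat as ℕ using (ℕ; zero; suc; NonZero; _%_)
import Data.Nat.Properties as ℕ
open import Data.Nat.DivMod
  using (_mod_; _/_; m<n⇒m%n≡m; m≡m%n+[m/n]*n; %-distribˡ-+; %-distribˡ-*; m%n%n≡m%n;
         [m+n]%n≡m%n; [m+kn]%n≡m%n; m*n%n≡0; n%n≡0)
open import Data.Nat.Divisibility using (_∣_; divides; m%n≡0⇒n∣m; n∣m⇒m%n≡0; ∣⇒≤)
open import Data.Nat.Primality using (Prime; euclidsLemma; prime⇒nonTrivial)
open import Data.Nat.Combinatorics using (nCk+nC[k+1]≡[n+1]C[k+1]; nC1≡n; nCn≡1) renaming (_C_ to _choose_)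
open import Data.Nat.Coprimality using (coprime-Bézout; prime⇒coprime)
open import Data.Nat.GCD using (module Bézout)
open import Data.Fin as Fin using (Fin; toℕ; inject₁; punchIn; punchOut)
import Data.Fin.Properties as Fin
open import Data.Bool using (Bool; true; false; not; if_then_else_)
open import Data.Bool.Properties using (not-involutive)
open import Data.Vec as Vec using (Vec; []; _∷_; lookup; tabulate; removeAt)
import Data.Vec.Properties as Vec
open import Data.Vec.Functional using (Vector; insertAt)
import Data.Vec.Functional.Properties as Vector
open import Data.Empty using (⊥-elim)
open import Function using (_∘_)
open import Relation.Nullary using (¬_; does; yes; no; ofʸ; ofⁿ; Dec; ¬?)
open import Relation.Binary.Definitions using (tri<; tri≈; tri>)
open import Data.Product using (Σ; ∃; _×_; _,_; proj₁; proj₂)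
open import Data.Sum using (_⊎_; inj₁; inj₂)
open import Function.Bundles using (_⇔_; mk⇔; Equivalence)
open import Function.Construct.Composition using (_⇔-∘_)
open import Function.Construct.Symmetry using (⇔-sym)
open import Data.Vec.Membership.Propositional using (_∈_)
open import Data.Vec.Relation.Unary.Any using (here; there)
import Data.Vec.Relation.Unary.Any as Any
import Data.Vec.Relation.Unary.Any.Properties as Any
import Data.Vec.Membership.Propositional.Properties as VecMembership
open import Data.List as List using (List)
import Data.List.Properties as List
import Data.List.Membership.Propositional as List
import Data.List.Membership.Propositional.Properties as List
import Data.List.Relation.Unary.Any as ListAny
open import Data.List.Relation.Unary.All as All using (All)
import Data.List.Relation.Unary.AllPairs as AllPairs
open import Data.List.Relation.Unary.Unique.Propositional using (Unique)
open import Relation.Binary.PropositionalEquality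
  using (_≡_; _≢_; _≗_; refl; sym; trans; cong; cong₂; subst; subst₂; isEquivalence; module ≡-Reasoning)
open import Algebra.Bundles using (CommutativeRing)
open import Algebra.Structures using (IsCommutativeRing)
import Algebra.Properties.Ring as RingProperties
import Algebra.Properties.Semiring.Sum as SemiringSum
import Algebra.Properties.Semiring.Mult as SemiringMult
import Algebra.Properties.Semiring.Exp as SemiringExp
import Algebra.Properties.CommutativeMonoid.Sum as CommutativeMonoidSum
import Algebra.Properties.CommutativeMonoid.Mult as CommutativeMonoidMult
import Algebra.Properties.CommutativeSemiring.Binomial as Binomial
open import Data.Fin.Permutation using (Permutation; permutation; _⟨$⟩ʳ_)
import Relation.Binary.Reasoning.Setoid as SetoidReasoning

lookup-ext : ∀ {A : Set} {n} {xs ys : Vec A n} → (∀ i → lookup xs i ≡ lookup ys i) → xs ≡ ys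
lookup-ext {xs = xs} {ys} xs≗ys = trans (sym (Vec.tabulate∘lookup xs)) (trans (Vec.tabulate-cong xs≗ys) (Vec.tabulate∘lookup ys))

[k+1]*[m+1]C[k+1]≡[m+1]*mCk : ∀ m k → suc k ℕ.* (suc m choose suc k) ≡ suc m ℕ.* (m choose k)
[k+1]*[m+1]C[k+1]≡[m+1]*mCk zero    zero    = refl
[k+1]*[m+1]C[k+1]≡[m+1]*mCk zero    (suc k) = ℕ.*-zeroʳ (suc (suc k))
[k+1]*[m+1]C[k+1]≡[m+1]*mCk (suc m) zero    = trans (ℕ.*-identityˡ _) (trans (nC1≡n (suc (suc m))) (sym (ℕ.*-identityʳ (suc (suc m)))))
[k+1]*[m+1]C[k+1]≡[m+1]*mCk (suc m) (suc k) = begin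
  suc (suc k) ℕ.* (suc S choose suc (suc k))                ≡⟨ cong (suc (suc k) ℕ.*_) (nCk+nC[k+1]≡[n+1]C[k+1] S (suc k)) ⟨
  suc (suc k) ℕ.* (A ℕ.+ B)                                 ≡⟨ ℕ.*-distribˡ-+ (suc (suc k)) A B ⟩
  suc (suc k) ℕ.* A ℕ.+ suc (suc k) ℕ.* B                   ≡⟨ cong (suc (suc k) ℕ.* A ℕ.+_) ([k+1]*[m+1]C[k+1]≡[m+1]*mCk m (suc k)) ⟩
  (A ℕ.+ suc k ℕ.* A) ℕ.+ S ℕ.* (m choose suc k)            ≡⟨ cong (λ x → (A ℕ.+ x) ℕ.+ S ℕ.* (m choose suc k)) ([k+1]*[m+1]C[k+1]≡[m+1]*mCk m k) ⟩
  (A ℕ.+ S ℕ.* (m choose k)) ℕ.+ S ℕ.* (m choose suc k)     ≡⟨ ℕ.+-assoc A (S ℕ.* (m choose k)) (S ℕ.* (m choose suc k)) ⟩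
  A ℕ.+ (S ℕ.* (m choose k) ℕ.+ S ℕ.* (m choose suc k))     ≡⟨ cong (A ℕ.+_) (ℕ.*-distribˡ-+ S (m choose k) (m choose suc k)) ⟨
  A ℕ.+ S ℕ.* (m choose k ℕ.+ m choose suc k)               ≡⟨ cong (λ x → A ℕ.+ S ℕ.* x) (nCk+nC[k+1]≡[n+1]C[k+1] m k) ⟩
  suc S ℕ.* A                                               ∎
  where
  open ≡-Reasoning
  S = suc m
  A = S choose suc k
  B = S choose suc (suc k)

prime∣pCk : ∀ {p} → Prime p → ∀ k → 0 ℕ.< k → k ℕ.< p → p ∣ p choose k
prime∣pCk {suc m} p-prime (suc k) _ k<p with euclidsLemma (suc k) (suc m choose suc k) p-prime
  (divides (m choose k) (trans ([k+1]*[m+1]C[k+1]≡[m+1]*mCk m k) (ℕ.*-comm (suc m) (m choose k))))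
... | inj₁ p∣k+1 = ⊥-elim (ℕ.<⇒≱ k<p (∣⇒≤ p∣k+1))
... | inj₂ p∣pCk = p∣pCk

module PrimeField (p : ℕ) .{{_ : NonZero p}} where

  [_] : ℕ → Fin p
  [ m ] = m mod p

  toℕ-[] : ∀ m → toℕ [ m ] ≡ m % p
  toℕ-[] m = Fin.toℕ-fromℕ< _

  0%p≡0 : 0 % p ≡ 0
  0%p≡0 = m<n⇒m%n≡m (ℕ.>-nonZero⁻¹ p)

  []-toℕ : ∀ a → [ toℕ a ] ≡ a
  []-toℕ a = Fin.toℕ-injective (trans (toℕ-[] (toℕ a)) (m<n⇒m%n≡m (Fin.toℕ<n a)))

  []-cong-% : ∀ {x y} → x % p ≡ y % p → [ x ] ≡ [ y ]
  []-cong-% {x} {y} e = Fin.toℕ-injective (trans (toℕ-[] x) (trans e (sym (toℕ-[] y))))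

  []-homo-+ : ∀ x y → [ x ] +ₚ [ y ] ≡ [ x ℕ.+ y ]
  []-homo-+ x y = []-cong-% (trans (cong₂ (λ a b → (a ℕ.+ b) % p) (toℕ-[] x) (toℕ-[] y)) (sym (%-distribˡ-+ x y p)))

  []-homo-* : ∀ x y → [ x ] *ₚ [ y ] ≡ [ x ℕ.* y ]
  []-homo-* x y = []-cong-% (trans (cong₂ (λ a b → (a ℕ.* b) % p) (toℕ-[] x) (toℕ-[] y)) (sym (%-distribˡ-* x y p)))

  -- every element is [ m ] for some m, so the ring laws can be transported from ℕ
  data Reduced : Fin p → Set where
    reduce : ∀ m → Reduced [ m ]

  reduced : ∀ a → Reduced a
  reduced a = subst Reduced ([]-toℕ a) (reduce (toℕ a))

  open ≡-Reasoning

  +ₚ-assoc : ∀ a b c → (a +ₚ b) +ₚ c ≡ a +ₚ (b +ₚ c)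
  +ₚ-assoc a b c with reduced a | reduced b | reduced c
  ... | reduce x | reduce y | reduce z = begin
    ([ x ] +ₚ [ y ]) +ₚ [ z ]  ≡⟨ cong (_+ₚ [ z ]) ([]-homo-+ x y) ⟩
    [ x ℕ.+ y ] +ₚ [ z ]       ≡⟨ []-homo-+ (x ℕ.+ y) z ⟩
    [ x ℕ.+ y ℕ.+ z ]          ≡⟨ cong [_] (ℕ.+-assoc x y z) ⟩
    [ x ℕ.+ (y ℕ.+ z) ]        ≡⟨ []-homo-+ x (y ℕ.+ z) ⟨
    [ x ] +ₚ [ y ℕ.+ z ]       ≡⟨ cong ([ x ] +ₚ_) ([]-homo-+ y z) ⟨
    [ x ] +ₚ ([ y ] +ₚ [ z ])  ∎

  *ₚ-assoc : ∀ a b c → (a *ₚ b) *ₚ c ≡ a *ₚ (b *ₚ c)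
  *ₚ-assoc a b c with reduced a | reduced b | reduced c
  ... | reduce x | reduce y | reduce z = begin
    ([ x ] *ₚ [ y ]) *ₚ [ z ]  ≡⟨ cong (_*ₚ [ z ]) ([]-homo-* x y) ⟩
    [ x ℕ.* y ] *ₚ [ z ]       ≡⟨ []-homo-* (x ℕ.* y) z ⟩
    [ x ℕ.* y ℕ.* z ]          ≡⟨ cong [_] (ℕ.*-assoc x y z) ⟩
    [ x ℕ.* (y ℕ.* z) ]        ≡⟨ []-homo-* x (y ℕ.* z) ⟨
    [ x ] *ₚ [ y ℕ.* z ]       ≡⟨ cong ([ x ] *ₚ_) ([]-homo-* y z) ⟨
    [ x ] *ₚ ([ y ] *ₚ [ z ])  ∎

  *ₚ-distribˡ-+ₚ : ∀ a b c → a *ₚ (b +ₚ c) ≡ (a *ₚ b) +ₚ (a *ₚ c)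
  *ₚ-distribˡ-+ₚ a b c with reduced a | reduced b | reduced c
  ... | reduce x | reduce y | reduce z = begin
    [ x ] *ₚ ([ y ] +ₚ [ z ])          ≡⟨ cong ([ x ] *ₚ_) ([]-homo-+ y z) ⟩
    [ x ] *ₚ [ y ℕ.+ z ]               ≡⟨ []-homo-* x (y ℕ.+ z) ⟩
    [ x ℕ.* (y ℕ.+ z) ]                ≡⟨ cong [_] (ℕ.*-distribˡ-+ x y z) ⟩
    [ x ℕ.* y ℕ.+ x ℕ.* z ]            ≡⟨ []-homo-+ (x ℕ.* y) (x ℕ.* z) ⟨
    [ x ℕ.* y ] +ₚ [ x ℕ.* z ]         ≡⟨ cong₂ _+ₚ_ ([]-homo-* x y) ([]-homo-* x z) ⟨
    ([ x ] *ₚ [ y ]) +ₚ ([ x ] *ₚ [ z ]) ∎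

  +ₚ-comm : ∀ a b → a +ₚ b ≡ b +ₚ a
  +ₚ-comm a b = cong [_] (ℕ.+-comm (toℕ a) (toℕ b))

  *ₚ-comm : ∀ a b → a *ₚ b ≡ b *ₚ a
  *ₚ-comm a b = cong [_] (ℕ.*-comm (toℕ a) (toℕ b))

  *ₚ-distribʳ-+ₚ : ∀ a b c → (b +ₚ c) *ₚ a ≡ (b *ₚ a) +ₚ (c *ₚ a)
  *ₚ-distribʳ-+ₚ a b c = begin
    (b +ₚ c) *ₚ a          ≡⟨ *ₚ-comm (b +ₚ c) a ⟩
    a *ₚ (b +ₚ c)          ≡⟨ *ₚ-distribˡ-+ₚ a b c ⟩
    (a *ₚ b) +ₚ (a *ₚ c)   ≡⟨ cong₂ _+ₚ_ (*ₚ-comm a b) (*ₚ-comm a c) ⟩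
    (b *ₚ a) +ₚ (c *ₚ a)   ∎

  +ₚ-identityˡ : ∀ a → 𝟘 +ₚ a ≡ a
  +ₚ-identityˡ a with reduced a
  ... | reduce x = []-homo-+ 0 x

  +ₚ-identityʳ : ∀ a → a +ₚ 𝟘 ≡ a
  +ₚ-identityʳ a = trans (+ₚ-comm a 𝟘) (+ₚ-identityˡ a)

  *ₚ-identityˡ : ∀ a → 𝟙 *ₚ a ≡ a
  *ₚ-identityˡ a with reduced a
  ... | reduce x = trans ([]-homo-* 1 x) (cong [_] (ℕ.*-identityˡ x))

  *ₚ-identityʳ : ∀ a → a *ₚ 𝟙 ≡ a
  *ₚ-identityʳ a = trans (*ₚ-comm a 𝟙) (*ₚ-identityˡ a)

  -ₚ-inverseˡ : ∀ a → (-ₚ a) +ₚ a ≡ 𝟘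
  -ₚ-inverseˡ a = begin
    [ p ℕ.∸ toℕ a ] +ₚ a          ≡⟨ cong ([ p ℕ.∸ toℕ a ] +ₚ_) ([]-toℕ a) ⟨
    [ p ℕ.∸ toℕ a ] +ₚ [ toℕ a ]  ≡⟨ []-homo-+ (p ℕ.∸ toℕ a) (toℕ a) ⟩
    [ p ℕ.∸ toℕ a ℕ.+ toℕ a ]     ≡⟨ cong [_] (ℕ.m∸n+n≡m (ℕ.<⇒≤ (Fin.toℕ<n a))) ⟩
    [ p ]                         ≡⟨ []-cong-% (trans (n%n≡0 p) (sym 0%p≡0)) ⟩
    𝟘                             ∎

  -ₚ-inverseʳ : ∀ a → a +ₚ (-ₚ a) ≡ 𝟘
  -ₚ-inverseʳ a = trans (+ₚ-comm a (-ₚ a)) (-ₚ-inverseˡ a)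

  +ₚ-*ₚ-isCommutativeRing : IsCommutativeRing _≡_ _+ₚ_ _*ₚ_ -ₚ_ 𝟘 𝟙
  +ₚ-*ₚ-isCommutativeRing = record
    { isRing = record
      { +-isAbelianGroup = record
        { isGroup = record
          { isMonoid = record
            { isSemigroup = record
              { isMagma = record { isEquivalence = isEquivalence ; ∙-cong = cong₂ _+ₚ_ }
              ; assoc = +ₚ-assoc }
            ; identity = +ₚ-identityˡ , +ₚ-identityʳ }
          ; inverse = -ₚ-inverseˡ , -ₚ-inverseʳ
          ; ⁻¹-cong = cong -ₚ_ }
        ; comm = +ₚ-comm }
      ; *-cong = cong₂ _*ₚ_
      ; *-assoc = *ₚ-assoc
      ; *-identity = *ₚ-identityˡ , *ₚ-identityʳ
      ; distrib = *ₚ-distribˡ-+ₚ , *ₚ-distribʳ-+ₚ }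
    ; *-comm = *ₚ-comm }

  +ₚ-*ₚ-commutativeRing : CommutativeRing 0ℓ 0ℓ
  +ₚ-*ₚ-commutativeRing = record { isCommutativeRing = +ₚ-*ₚ-isCommutativeRing }

  toℕ-𝟘 : toℕ 𝟘 ≡ 0
  toℕ-𝟘 = trans (toℕ-[] 0) 0%p≡0

  toℕ≡0⇒≡𝟘 : ∀ {a} → toℕ a ≡ 0 → a ≡ 𝟘
  toℕ≡0⇒≡𝟘 e = Fin.toℕ-injective (trans e (sym toℕ-𝟘))

  module _ (p-prime : Prime p) where

    open CommutativeRing +ₚ-*ₚ-commutativeRing using (ring)
    open RingProperties ring using (-‿distribʳ-*; -‿involutive; +-inverseʳ-unique)

    𝟙≢𝟘 : 𝟙 ≢ 𝟘
    𝟙≢𝟘 e = ℕ.1+n≢0 (begin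
      1          ≡⟨ m<n⇒m%n≡m (ℕ.nonTrivial⇒n>1 p {{prime⇒nonTrivial p-prime}}) ⟨
      1 % p      ≡⟨ toℕ-[] 1 ⟨
      toℕ 𝟙      ≡⟨ cong toℕ e ⟩
      toℕ 𝟘      ≡⟨ toℕ-𝟘 ⟩
      0          ∎)

    p∣toℕ⇒≡𝟘 : ∀ {a} → p ∣ toℕ a → a ≡ 𝟘
    p∣toℕ⇒≡𝟘 {a} d = toℕ≡0⇒≡𝟘 (trans (sym (m<n⇒m%n≡m (Fin.toℕ<n a))) (n∣m⇒m%n≡0 _ p d))

    *ₚ≡𝟘⇒ : ∀ a b → a *ₚ b ≡ 𝟘 → a ≡ 𝟘 ⊎ b ≡ 𝟘
    *ₚ≡𝟘⇒ a b e with euclidsLemma (toℕ a) (toℕ b) p-prime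
                         (m%n≡0⇒n∣m _ p (trans (sym (toℕ-[] (toℕ a ℕ.* toℕ b))) (trans (cong toℕ e) toℕ-𝟘)))
    ... | inj₁ p∣a = inj₁ (p∣toℕ⇒≡𝟘 p∣a)
    ... | inj₂ p∣b = inj₂ (p∣toℕ⇒≡𝟘 p∣b)

    *ₚ≢𝟘 : ∀ {a b} → a ≢ 𝟘 → b ≢ 𝟘 → a *ₚ b ≢ 𝟘
    *ₚ≢𝟘 {a} {b} a≢𝟘 b≢𝟘 e with *ₚ≡𝟘⇒ a b e
    ... | inj₁ a≡𝟘 = a≢𝟘 a≡𝟘
    ... | inj₂ b≡𝟘 = b≢𝟘 b≡𝟘

    *ₚ-inverse : ∀ a → a ≢ 𝟘 → ∃ λ b → a *ₚ b ≡ 𝟙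
    *ₚ-inverse a a≢𝟘 = fromBézout (coprime-Bézout (prime⇒coprime p-prime {{toℕ-nonZero}} (Fin.toℕ<n a)))
      where
      toℕ-nonZero : NonZero (toℕ a)
      toℕ-nonZero = ℕ.≢-nonZero (λ e → a≢𝟘 (toℕ≡0⇒≡𝟘 e))
      fromBézout : Bézout.Identity 1 p (toℕ a) → ∃ λ b → a *ₚ b ≡ 𝟙
      fromBézout (Bézout.-+ x y eq) = [ y ] , (begin
        a *ₚ [ y ]             ≡⟨ cong (_*ₚ [ y ]) ([]-toℕ a) ⟨
        [ toℕ a ] *ₚ [ y ]     ≡⟨ []-homo-* (toℕ a) y ⟩
        [ toℕ a ℕ.* y ]        ≡⟨ cong [_] (trans (ℕ.*-comm (toℕ a) y) (sym eq)) ⟩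
        [ 1 ℕ.+ x ℕ.* p ]      ≡⟨ []-cong-% ([m+kn]%n≡m%n 1 x p) ⟩
        𝟙                      ∎)
      fromBézout (Bézout.+- x y eq) = -ₚ [ y ] , (begin
        a *ₚ (-ₚ [ y ])        ≡⟨ -‿distribʳ-* a [ y ] ⟨
        -ₚ (a *ₚ [ y ])        ≡⟨ cong -ₚ_ a*y≡-𝟙 ⟩
        -ₚ (-ₚ 𝟙)              ≡⟨ -‿involutive 𝟙 ⟩
        𝟙                      ∎)
        where
        𝟙+a*y≡𝟘 : 𝟙 +ₚ (a *ₚ [ y ]) ≡ 𝟘
        𝟙+a*y≡𝟘 = begin
          𝟙 +ₚ (a *ₚ [ y ])                ≡⟨ cong (λ b → 𝟙 +ₚ (b *ₚ [ y ])) ([]-toℕ a) ⟨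
          𝟙 +ₚ ([ toℕ a ] *ₚ [ y ])        ≡⟨ cong (𝟙 +ₚ_) ([]-homo-* (toℕ a) y) ⟩
          𝟙 +ₚ [ toℕ a ℕ.* y ]           ≡⟨ []-homo-+ 1 (toℕ a ℕ.* y) ⟩
          [ 1 ℕ.+ toℕ a ℕ.* y ]          ≡⟨ cong (λ m → [ 1 ℕ.+ m ]) (ℕ.*-comm (toℕ a) y) ⟩
          [ 1 ℕ.+ y ℕ.* toℕ a ]          ≡⟨ cong [_] eq ⟩
          [ x ℕ.* p ]                    ≡⟨ []-cong-% (trans (m*n%n≡0 x p) (sym 0%p≡0)) ⟩
          𝟘                              ∎
        a*y≡-𝟙 : a *ₚ [ y ] ≡ -ₚ 𝟙
        a*y≡-𝟙 = +-inverseʳ-unique 𝟙 (a *ₚ [ y ]) 𝟙+a*y≡𝟘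

module Determinant (p : ℕ) .{{_ : NonZero p}} where

  open PrimeField p
  open CommutativeRing +ₚ-*ₚ-commutativeRing
    using (_+_; _*_; -_; 0#; 1#; +-assoc; +-identityˡ; +-identityʳ; *-assoc; *-comm; *-identityˡ;
           zeroˡ; zeroʳ; distribˡ; distribʳ; -‿inverseˡ; -‿inverseʳ; ring; semiring)
  open RingProperties ring using (+-inverseʳ-unique; -‿involutive; -0#≈0#)
  open SemiringSum semiring using (sum; sum-cong-≗; sum-remove; sum-replicate-zero; ∑-distrib-+; *-distribˡ-sum)
  open ≡-Reasoning

  Matrix : ℕ → Set
  Matrix n = Fin n → Fin n → Fin p

  infix 4 _≋_
  _≋_ : ∀ {n} → Matrix n → Matrix n → Set
  M ≋ N = ∀ i j → M i j ≡ N i j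

  ⟦_⟧ : ∀ {n} → Mat p n → Matrix n
  ⟦ A ⟧ i j = lookup (lookup A i) j

  even : ℕ → Bool
  even x = does (x mod 2 Fin.≟ Fin.zero)

  even-suc : ∀ x → even (suc x) ≡ not (even x)
  even-suc zero = refl
  even-suc (suc x) = begin
    even (suc (suc x))  ≡⟨ cong (λ r → does (r Fin.≟ Fin.zero)) 2+x≡x ⟩
    even x              ≡⟨ not-involutive (even x) ⟨
    not (not (even x))  ≡⟨ cong not (even-suc x) ⟨
    not (even (suc x))  ∎
    where
    2+x≡x : suc (suc x) mod 2 ≡ x mod 2
    2+x≡x = Fin.toℕ-injective (begin
      toℕ (suc (suc x) mod 2)  ≡⟨ Fin.toℕ-fromℕ< _ ⟩
      suc (suc x) % 2          ≡⟨ cong (_% 2) (ℕ.+-comm 2 x) ⟩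
      (x ℕ.+ 2) % 2            ≡⟨ [m+n]%n≡m%n x 2 ⟩
      x % 2                    ≡⟨ Fin.toℕ-fromℕ< _ ⟨
      toℕ (x mod 2)            ∎)

  -- must agree definitionally with the sign in Defs.det, see det≡det′
  sgn : ∀ {n} → Fin n → Fin p
  sgn j = if even (toℕ j) then 1# else - 1#

  sgn-inject₁+sgn-suc : ∀ {n} (k : Fin n) → sgn (inject₁ k) + sgn (Fin.suc k) ≡ 0#
  sgn-inject₁+sgn-suc k rewrite Fin.toℕ-inject₁ k | even-suc (toℕ k) with even (toℕ k)
  ... | true  = -‿inverseʳ 1#
  ... | false = -‿inverseˡ 1#

  minor : ∀ {n} → Fin (suc n) → Matrix (suc n) → Matrix n
  minor j M i k = M (Fin.suc i) (punchIn j k)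

  mutual
    det′ : ∀ {n} → Matrix n → Fin p
    det′ {zero}  M = 1#
    det′ {suc n} M = sum (cofactorTerm M)

    cofactorTerm : ∀ {n} → Matrix (suc n) → Fin (suc n) → Fin p
    cofactorTerm M j = sgn j * (M Fin.zero j * det′ (minor j M))

  det′-cong : ∀ {n} {M N : Matrix n} → M ≋ N → det′ M ≡ det′ N
  det′-cong {zero}  M≋N = refl
  det′-cong {suc n} M≋N = sum-cong-≗ λ j →
    cong₂ (λ x d → sgn j * (x * d)) (M≋N Fin.zero j) (det′-cong (λ i k → M≋N (Fin.suc i) (punchIn j k)))

  cofactorTerm-zero : ∀ {n} (M : Matrix (suc n)) j → M Fin.zero j ≡ 0# → cofactorTerm M j ≡ 0#
  cofactorTerm-zero M j M₀ⱼ≡0 = begin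
    sgn j * (M Fin.zero j * det′ (minor j M))  ≡⟨ cong (λ x → sgn j * (x * det′ (minor j M))) M₀ⱼ≡0 ⟩
    sgn j * (0# * det′ (minor j M))            ≡⟨ cong (sgn j *_) (zeroˡ (det′ (minor j M))) ⟩
    sgn j * 0#                                 ≡⟨ zeroʳ (sgn j) ⟩
    0#                                         ∎

  sumₚ≡sum : ∀ {n} (f : Fin n → Fin p) → sumₚ f ≡ sum f
  sumₚ≡sum {zero}  f = refl
  sumₚ≡sum {suc n} f = cong (f Fin.zero +_) (sumₚ≡sum (f ∘ Fin.suc))

  lookup-removeAt : ∀ {A : Set} {n} (xs : Vec A (suc n)) i j → lookup (removeAt xs i) j ≡ lookup xs (punchIn i j)
  lookup-removeAt xs i j = trans (cong (lookup (removeAt xs i)) (sym (Fin.punchOut-punchIn i)))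
                                 (Vec.removeAt-punchOut xs (Fin.punchInᵢ≢i i j ∘ sym))

  det≡det′ : ∀ {n} (A : Mat p n) → det A ≡ det′ ⟦ A ⟧
  det≡det′ {zero}  []       = refl
  det≡det′ {suc n} (r ∷ rs) = trans (sumₚ≡sum (λ j → sgn j * (lookup r j * det (minorᵛ j)))) (sum-cong-≗ λ j →
    cong (λ d → sgn j * (lookup r j * d)) (trans (det≡det′ (minorᵛ j)) (det′-cong (minor≋ j))))
    where
    minorᵛ : Fin (suc n) → Mat p n
    minorᵛ j = Vec.map (λ row → removeAt row j) rs
    minor≋ : ∀ j → ⟦ minorᵛ j ⟧ ≋ minor j ⟦ r ∷ rs ⟧
    minor≋ j i k = trans (cong (λ row → lookup row k) (Vec.lookup-map i _ rs)) (lookup-removeAt (lookup rs i) j k)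

  sum-zero : ∀ {n} (f : Fin n → Fin p) → (∀ i → f i ≡ 0#) → sum f ≡ 0#
  sum-zero {n} f f≡0 = trans (sum-cong-≗ f≡0) (sum-replicate-zero n)

  sum-single : ∀ {n} (f : Fin n → Fin p) (k : Fin n) → (∀ j → j ≢ k → f j ≡ 0#) → sum f ≡ f k
  sum-single {suc n} f k f≡0 = begin
    sum f                          ≡⟨ sum-remove {i = k} f ⟩
    f k + sum (f ∘ punchIn k)      ≡⟨ cong (f k +_) (sum-zero _ (λ l → f≡0 (punchIn k l) (Fin.punchInᵢ≢i k l))) ⟩
    f k + 0#                       ≡⟨ +-identityʳ (f k) ⟩
    f k                            ∎

  sum-adjacent-pair : ∀ {m} (f : Fin (suc (suc m)) → Fin p) (k : Fin (suc m)) →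
    (∀ j → j ≢ inject₁ k → j ≢ Fin.suc k → f j ≡ 0#) → f (inject₁ k) + f (Fin.suc k) ≡ 0# → sum f ≡ 0#
  sum-adjacent-pair f Fin.zero f≡0 pair = begin
    f Fin.zero + (f (Fin.suc Fin.zero) + sum (f ∘ Fin.suc ∘ Fin.suc))  ≡⟨ +-assoc _ _ _ ⟨
    (f Fin.zero + f (Fin.suc Fin.zero)) + sum (f ∘ Fin.suc ∘ Fin.suc)  ≡⟨ cong₂ _+_ pair (sum-zero (f ∘ Fin.suc ∘ Fin.suc) (λ j → f≡0 (Fin.suc (Fin.suc j)) (λ ()) (λ ()))) ⟩
    0# + 0#                                                            ≡⟨ +-identityˡ 0# ⟩
    0#                                                                 ∎
  sum-adjacent-pair {suc m} f (Fin.suc k) f≡0 pair = begin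
    f Fin.zero + sum (f ∘ Fin.suc)  ≡⟨ cong₂ _+_ (f≡0 Fin.zero (λ ()) (λ ())) (sum-adjacent-pair (f ∘ Fin.suc) k f∘suc≡0 pair) ⟩
    0# + 0#                         ≡⟨ +-identityˡ 0# ⟩
    0#                              ∎
    where
    f∘suc≡0 : ∀ j → j ≢ inject₁ k → j ≢ Fin.suc k → f (Fin.suc j) ≡ 0#
    f∘suc≡0 j j≢k j≢k+1 = f≡0 (Fin.suc j) (j≢k ∘ Fin.suc-injective) (j≢k+1 ∘ Fin.suc-injective)

  sum-linear : ∀ {n} (c : Fin p) (f g : Fin n → Fin p) → sum (λ i → f i + c * g i) ≡ sum f + c * sum g
  sum-linear c f g = trans (∑-distrib-+ f (λ i → c * g i)) (cong (sum f +_) (sym (*-distribˡ-sum c g)))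

  *-distribˡ-+-scaled : ∀ c s u v → s * (u + c * v) ≡ s * u + c * (s * v)
  *-distribˡ-+-scaled c s u v = begin
    s * (u + c * v)      ≡⟨ distribˡ s u (c * v) ⟩
    s * u + s * (c * v)  ≡⟨ cong (s * u +_) (*-assoc s c v) ⟨
    s * u + s * c * v    ≡⟨ cong (λ x → s * u + x * v) (*-comm s c) ⟩
    s * u + c * s * v    ≡⟨ cong (s * u +_) (*-assoc c s v) ⟩
    s * u + c * (s * v)  ∎

  det′-linear : ∀ {n} (k : Fin n) (c : Fin p) {A B C : Matrix n} →
    (∀ i j → j ≢ k → A i j ≡ C i j) → (∀ i j → j ≢ k → B i j ≡ C i j) →
    (∀ i → C i k ≡ A i k + c * B i k) → det′ C ≡ det′ A + c * det′ B
  det′-linear {suc n} k c {A} {B} {C} A≡C B≡C Cₖ =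
    trans (sum-cong-≗ term) (sum-linear c (cofactorTerm A) (cofactorTerm B))
    where
    term : ∀ j → cofactorTerm C j ≡ cofactorTerm A j + c * cofactorTerm B j
    term j with j Fin.≟ k
    ... | yes refl = begin
      sgn j * (C Fin.zero j * det′ (minor j C))                       ≡⟨ cong₂ (λ x d → sgn j * (x * d)) (Cₖ Fin.zero) (det′-cong minorC≋minorA) ⟩
      sgn j * ((A Fin.zero j + c * B Fin.zero j) * det′ (minor j A))  ≡⟨ cong (sgn j *_) (distribʳ _ (A Fin.zero j) (c * B Fin.zero j)) ⟩
      sgn j * (A Fin.zero j * dA + c * B Fin.zero j * dA)             ≡⟨ cong (λ x → sgn j * (A Fin.zero j * dA + x)) (*-assoc c (B Fin.zero j) dA) ⟩
      sgn j * (A Fin.zero j * dA + c * (B Fin.zero j * dA))           ≡⟨ *-distribˡ-+-scaled c (sgn j) _ _ ⟩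
      cofactorTerm A j + c * (sgn j * (B Fin.zero j * dA))            ≡⟨ cong (λ d → cofactorTerm A j + c * (sgn j * (B Fin.zero j * d))) (det′-cong minorA≋minorB) ⟩
      cofactorTerm A j + c * cofactorTerm B j                         ∎
      where
      dA = det′ (minor j A)
      minorC≋minorA : minor j C ≋ minor j A
      minorC≋minorA i l = sym (A≡C (Fin.suc i) (punchIn j l) (Fin.punchInᵢ≢i j l))
      minorA≋minorB : minor j A ≋ minor j B
      minorA≋minorB i l = trans (A≡C (Fin.suc i) (punchIn j l) (Fin.punchInᵢ≢i j l))
                                (sym (B≡C (Fin.suc i) (punchIn j l) (Fin.punchInᵢ≢i j l)))
    ... | no j≢k = begin
      sgn j * (C Fin.zero j * det′ (minor j C))                                 ≡⟨ cong (λ d → sgn j * (C Fin.zero j * d)) minor-linear ⟩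
      sgn j * (C Fin.zero j * (det′ (minor j A) + c * det′ (minor j B)))        ≡⟨ cong (sgn j *_) (*-distribˡ-+-scaled c (C Fin.zero j) _ _) ⟩
      sgn j * (C Fin.zero j * det′ (minor j A) + c * (C Fin.zero j * det′ (minor j B))) ≡⟨ *-distribˡ-+-scaled c (sgn j) _ _ ⟩
      sgn j * (C Fin.zero j * det′ (minor j A)) + c * (sgn j * (C Fin.zero j * det′ (minor j B)))
        ≡⟨ cong₂ (λ x y → sgn j * (x * det′ (minor j A)) + c * (sgn j * (y * det′ (minor j B))))
                 (sym (A≡C Fin.zero j j≢k)) (sym (B≡C Fin.zero j j≢k)) ⟩
      cofactorTerm A j + c * cofactorTerm B j                                   ∎
      where
      k′ = punchOut j≢k
      punchIn≢k : ∀ l → l ≢ k′ → punchIn j l ≢ k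
      punchIn≢k l l≢k′ e = l≢k′ (Fin.punchIn-injective j l k′ (trans e (sym (Fin.punchIn-punchOut j≢k))))
      minor-linear : det′ (minor j C) ≡ det′ (minor j A) + c * det′ (minor j B)
      minor-linear = det′-linear k′ c
        (λ i l l≢k′ → A≡C (Fin.suc i) (punchIn j l) (punchIn≢k l l≢k′))
        (λ i l l≢k′ → B≡C (Fin.suc i) (punchIn j l) (punchIn≢k l l≢k′))
        (λ i → subst (λ x → C (Fin.suc i) x ≡ A (Fin.suc i) x + c * B (Fin.suc i) x)
                     (sym (Fin.punchIn-punchOut j≢k)) (Cₖ (Fin.suc i)))

  punchIn-adjacent : ∀ {m} (j : Fin (suc (suc m))) (k : Fin (suc m)) → j ≢ inject₁ k → j ≢ Fin.suc k →
    ∃ λ (k′ : Fin m) → punchIn j (inject₁ k′) ≡ inject₁ k × punchIn j (Fin.suc k′) ≡ Fin.suc k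
  punchIn-adjacent Fin.zero Fin.zero j≢k _ = ⊥-elim (j≢k refl)
  punchIn-adjacent {suc m} Fin.zero (Fin.suc k) _ _ = k , refl , refl
  punchIn-adjacent (Fin.suc Fin.zero) Fin.zero _ j≢k+1 = ⊥-elim (j≢k+1 refl)
  punchIn-adjacent {suc m} (Fin.suc (Fin.suc j)) Fin.zero _ _ = Fin.zero , refl , refl
  punchIn-adjacent {suc m} (Fin.suc j) (Fin.suc k) j≢k j≢k+1
    with punchIn-adjacent j k (j≢k ∘ cong Fin.suc) (j≢k+1 ∘ cong Fin.suc)
  ... | k′ , e₁ , e₂ = Fin.suc k′ , cong Fin.suc e₁ , cong Fin.suc e₂

  punchIn-inject₁-suc : ∀ {m} (k c : Fin (suc m)) →
    punchIn (inject₁ k) c ≡ punchIn (Fin.suc k) c ⊎ (punchIn (inject₁ k) c ≡ Fin.suc k × punchIn (Fin.suc k) c ≡ inject₁ k)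
  punchIn-inject₁-suc Fin.zero Fin.zero = inj₂ (refl , refl)
  punchIn-inject₁-suc Fin.zero (Fin.suc c) = inj₁ refl
  punchIn-inject₁-suc {suc m} (Fin.suc k) Fin.zero = inj₁ refl
  punchIn-inject₁-suc {suc m} (Fin.suc k) (Fin.suc c) with punchIn-inject₁-suc k c
  ... | inj₁ e = inj₁ (cong Fin.suc e)
  ... | inj₂ (e₁ , e₂) = inj₂ (cong Fin.suc e₁ , cong Fin.suc e₂)

  det′-adjacent-equal : ∀ {n} (M : Matrix (suc n)) (k : Fin n) →
    (∀ i → M i (inject₁ k) ≡ M i (Fin.suc k)) → det′ M ≡ 0#
  det′-adjacent-equal {suc m} M k Mₖ≡Mₖ₊₁ = sum-adjacent-pair (cofactorTerm M) k other pair
    where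
    other : ∀ j → j ≢ inject₁ k → j ≢ Fin.suc k → cofactorTerm M j ≡ 0#
    other j j≢k j≢k+1 with punchIn-adjacent j k j≢k j≢k+1
    ... | k′ , e₁ , e₂ = begin
      sgn j * (M Fin.zero j * det′ (minor j M))  ≡⟨ cong (λ d → sgn j * (M Fin.zero j * d)) (det′-adjacent-equal (minor j M) k′ equal) ⟩
      sgn j * (M Fin.zero j * 0#)                ≡⟨ cong (sgn j *_) (zeroʳ (M Fin.zero j)) ⟩
      sgn j * 0#                                 ≡⟨ zeroʳ (sgn j) ⟩
      0#                                         ∎
      where
      equal : ∀ i → minor j M i (inject₁ k′) ≡ minor j M i (Fin.suc k′)
      equal i = subst₂ (λ x y → M (Fin.suc i) x ≡ M (Fin.suc i) y) (sym e₁) (sym e₂) (Mₖ≡Mₖ₊₁ (Fin.suc i))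
    -- removing either of two equal columns leaves the same minor, and the two signs are opposite
    minors≋ : minor (inject₁ k) M ≋ minor (Fin.suc k) M
    minors≋ i c with punchIn-inject₁-suc k c
    ... | inj₁ e = cong (M (Fin.suc i)) e
    ... | inj₂ (e₁ , e₂) = trans (cong (M (Fin.suc i)) e₁) (trans (sym (Mₖ≡Mₖ₊₁ (Fin.suc i))) (cong (M (Fin.suc i)) (sym e₂)))
    X = M Fin.zero (Fin.suc k) * det′ (minor (Fin.suc k) M)
    pair : cofactorTerm M (inject₁ k) + cofactorTerm M (Fin.suc k) ≡ 0#
    pair = begin
      sgn (inject₁ k) * (M Fin.zero (inject₁ k) * det′ (minor (inject₁ k) M)) + sgn (Fin.suc k) * X
        ≡⟨ cong₂ (λ x d → sgn (inject₁ k) * (x * d) + sgn (Fin.suc k) * X) (Mₖ≡Mₖ₊₁ Fin.zero) (det′-cong minors≋) ⟩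
      sgn (inject₁ k) * X + sgn (Fin.suc k) * X  ≡⟨ distribʳ X (sgn (inject₁ k)) (sgn (Fin.suc k)) ⟨
      (sgn (inject₁ k) + sgn (Fin.suc k)) * X    ≡⟨ cong (_* X) (sgn-inject₁+sgn-suc k) ⟩
      0# * X                                     ≡⟨ zeroˡ X ⟩
      0#                                         ∎

  setColumn : ∀ {n} → Matrix n → Fin n → Vector (Fin p) n → Matrix n
  setColumn M k u i j = if does (j Fin.≟ k) then u i else M i j

  setColumn-≡ : ∀ {n} (M : Matrix n) k u i → setColumn M k u i k ≡ u i
  setColumn-≡ M k u i with k Fin.≟ k
  ... | yes _   = refl
  ... | no k≢k  = ⊥-elim (k≢k refl)

  setColumn-≢ : ∀ {n} (M : Matrix n) k u i {j} → j ≢ k → setColumn M k u i j ≡ M i j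
  setColumn-≢ M k u i {j} j≢k with j Fin.≟ k
  ... | yes j≡k = ⊥-elim (j≢k j≡k)
  ... | no _    = refl

  det′-setColumn-+ : ∀ {n} (M : Matrix n) k (u v : Vector (Fin p) n) →
    det′ (setColumn M k (λ i → u i + v i)) ≡ det′ (setColumn M k u) + det′ (setColumn M k v)
  det′-setColumn-+ M k u v = trans
    (det′-linear k 1# (λ i j j≢k → trans (setColumn-≢ M k u i j≢k) (sym (setColumn-≢ M k u+v i j≢k)))
                      (λ i j j≢k → trans (setColumn-≢ M k v i j≢k) (sym (setColumn-≢ M k u+v i j≢k)))
                      (λ i → trans (setColumn-≡ M k u+v i)
                                   (sym (cong₂ _+_ (setColumn-≡ M k u i) (trans (*-identityˡ _) (setColumn-≡ M k v i))))))
    (cong (det′ (setColumn M k u) +_) (*-identityˡ (det′ (setColumn M k v))))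
    where
    u+v = λ i → u i + v i

  alternating⇒antisymmetric : ∀ {V : Set} (_⊕_ : V → V → V) (D : V → V → Fin p) → (∀ u → D u u ≡ 0#) →
    (∀ u v w → D u (v ⊕ w) ≡ D u v + D u w) → (∀ u v w → D (u ⊕ v) w ≡ D u w + D v w) →
    ∀ x y → D x y + D y x ≡ 0#
  alternating⇒antisymmetric _⊕_ D D-diag D-linearʳ D-linearˡ x y = begin
    D x y + D y x                          ≡⟨ cong₂ _+_ (+-identityˡ (D x y)) (+-identityʳ (D y x)) ⟨
    (0# + D x y) + (D y x + 0#)            ≡⟨ cong₂ (λ a b → (a + D x y) + (D y x + b)) (D-diag x) (D-diag y) ⟨
    (D x x + D x y) + (D y x + D y y)      ≡⟨ cong₂ _+_ (D-linearʳ x x y) (D-linearʳ y x y) ⟨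
    D x (x ⊕ y) + D y (x ⊕ y)              ≡⟨ D-linearˡ x y (x ⊕ y) ⟨
    D (x ⊕ y) (x ⊕ y)                      ≡⟨ D-diag (x ⊕ y) ⟩
    0#                                     ∎

  swapAdjacent : ∀ {m} → Matrix (suc (suc m)) → Fin (suc m) → Matrix (suc (suc m))
  swapAdjacent M k = setColumn (setColumn M (inject₁ k) (λ i → M i (Fin.suc k))) (Fin.suc k) (λ i → M i (inject₁ k))

  inject₁≢suc : ∀ {m} (k : Fin m) → inject₁ k ≢ Fin.suc k
  inject₁≢suc k e = ℕ.1+n≢n (sym (trans (sym (Fin.toℕ-inject₁ k)) (cong toℕ e)))

  det′-swapAdjacent : ∀ {m} (M : Matrix (suc (suc m))) (k : Fin (suc m)) → det′ (swapAdjacent M k) ≡ - det′ M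
  det′-swapAdjacent {m} M k = +-inverseʳ-unique (det′ M) (det′ (swapAdjacent M k))
    (subst (λ d → d + D y x ≡ 0#) (det′-cong unswapped)
      (alternating⇒antisymmetric (λ u v i → u i + v i) D D-diag D-linearʳ D-linearˡ x y))
    where
    a = inject₁ k
    b = Fin.suc k
    x y : Vector (Fin p) (suc (suc m))
    x i = M i a
    y i = M i b
    D : Vector (Fin p) (suc (suc m)) → Vector (Fin p) (suc (suc m)) → Fin p
    D u v = det′ (setColumn (setColumn M a u) b v)
    setColumn-comm : ∀ u v → setColumn (setColumn M a u) b v ≋ setColumn (setColumn M b v) a u
    setColumn-comm u v i c with c Fin.≟ b | c Fin.≟ a
    ... | yes refl | yes c≡a = ⊥-elim (inject₁≢suc k (sym c≡a))
    ... | yes _    | no _    = refl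
    ... | no _     | yes _   = refl
    ... | no _     | no _    = refl
    D-diag : ∀ u → D u u ≡ 0#
    D-diag u = det′-adjacent-equal (setColumn (setColumn M a u) b u) k (λ i → trans (setColumn-≢ (setColumn M a u) b u i (inject₁≢suc k))
                                                  (trans (setColumn-≡ M a u i) (sym (setColumn-≡ (setColumn M a u) b u i))))
    D-linearʳ : ∀ u v w → D u (λ i → v i + w i) ≡ D u v + D u w
    D-linearʳ u = det′-setColumn-+ (setColumn M a u) b
    D-linearˡ : ∀ u v w → D (λ i → u i + v i) w ≡ D u w + D v w
    D-linearˡ u v w = begin
      D (λ i → u i + v i) w                                 ≡⟨ det′-cong (setColumn-comm (λ i → u i + v i) w) ⟩
      det′ (setColumn (setColumn M b w) a (λ i → u i + v i)) ≡⟨ det′-setColumn-+ (setColumn M b w) a u v ⟩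
      det′ (setColumn (setColumn M b w) a u) + det′ (setColumn (setColumn M b w) a v)
                                                            ≡⟨ cong₂ _+_ (det′-cong (setColumn-comm u w)) (det′-cong (setColumn-comm v w)) ⟨
      D u w + D v w                                         ∎
    unswapped : setColumn (setColumn M a x) b y ≋ M
    unswapped i c with c Fin.≟ b | c Fin.≟ a
    ... | yes refl | _        = refl
    ... | no _     | yes refl = refl
    ... | no _     | no _     = refl

  det′-equal-columns-at-distance : ∀ d {m} (M : Matrix (suc (suc m))) a (k : Fin (suc m)) →
    toℕ k ≡ toℕ a ℕ.+ d → (∀ i → M i a ≡ M i (Fin.suc k)) → det′ M ≡ 0#
  det′-equal-columns-at-distance zero M a k k≡a Mₐ≡Mₖ₊₁ = det′-adjacent-equal M k (λ i → trans (cong (M i) (sym a≡k)) (Mₐ≡Mₖ₊₁ i))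
    where
    a≡k : a ≡ inject₁ k
    a≡k = Fin.toℕ-injective (trans (sym (ℕ.+-identityʳ (toℕ a))) (trans (sym k≡a) (sym (Fin.toℕ-inject₁ k))))
  det′-equal-columns-at-distance (suc d) M a Fin.zero 0≡a+d+1 _ = ⊥-elim (ℕ.0≢1+n (trans 0≡a+d+1 (ℕ.+-suc (toℕ a) d)))
  det′-equal-columns-at-distance (suc d) {suc m} M a (Fin.suc k) k+1≡a+d+1 Mₐ≡Mₖ₊₂ = begin
    det′ M          ≡⟨ -‿involutive (det′ M) ⟨
    - - det′ M      ≡⟨ cong -_ (det′-swapAdjacent M (Fin.suc k)) ⟨
    - det′ M′       ≡⟨ cong -_ (det′-equal-columns-at-distance d M′ a (inject₁ k) k≡a+d M′ₐ≡M′ₖ₊₁) ⟩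
    - 0#            ≡⟨ -0#≈0# ⟩
    0#              ∎
    where
    M′ = swapAdjacent M (Fin.suc k)
    k≡a+d : toℕ (inject₁ k) ≡ toℕ a ℕ.+ d
    k≡a+d = trans (Fin.toℕ-inject₁ k) (ℕ.suc-injective (trans k+1≡a+d+1 (ℕ.+-suc (toℕ a) d)))
    a<k+1 : toℕ a ℕ.< toℕ (Fin.suc k)
    a<k+1 = ℕ.s≤s (subst (toℕ a ℕ.≤_) (sym (trans (sym (Fin.toℕ-inject₁ k)) k≡a+d)) (ℕ.m≤m+n (toℕ a) d))
    a≢k+1 : a ≢ inject₁ (Fin.suc k)
    a≢k+1 e = ℕ.<⇒≢ a<k+1 (trans (cong toℕ e) (Fin.toℕ-inject₁ (Fin.suc k)))
    a≢k+2 : a ≢ Fin.suc (Fin.suc k)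
    a≢k+2 e = ℕ.<⇒≢ (ℕ.m<n⇒m<1+n a<k+1) (cong toℕ e)
    u v : Vector (Fin p) (suc (suc (suc m)))
    u i = M i (Fin.suc (Fin.suc k))
    v i = M i (inject₁ (Fin.suc k))
    M₁ = setColumn M (inject₁ (Fin.suc k)) u
    M′ₐ≡M′ₖ₊₁ : ∀ i → M′ i a ≡ M′ i (Fin.suc (inject₁ k))
    M′ₐ≡M′ₖ₊₁ i = begin
      M′ i a                              ≡⟨ setColumn-≢ M₁ (Fin.suc (Fin.suc k)) v i a≢k+2 ⟩
      M₁ i a                              ≡⟨ setColumn-≢ M (inject₁ (Fin.suc k)) u i a≢k+1 ⟩
      M i a                               ≡⟨ Mₐ≡Mₖ₊₂ i ⟩
      M i (Fin.suc (Fin.suc k))           ≡⟨ setColumn-≡ M (inject₁ (Fin.suc k)) u i ⟨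
      M₁ i (inject₁ (Fin.suc k))          ≡⟨ setColumn-≢ M₁ (Fin.suc (Fin.suc k)) v i (inject₁≢suc (Fin.suc k)) ⟨
      M′ i (Fin.suc (inject₁ k))          ∎

  det′-equal-columns< : ∀ {n} (M : Matrix n) a b → toℕ a ℕ.< toℕ b → (∀ i → M i a ≡ M i b) → det′ M ≡ 0#
  det′-equal-columns< {suc (suc m)} M a (Fin.suc k) a<b =
    det′-equal-columns-at-distance (toℕ k ℕ.∸ toℕ a) M a k (sym (ℕ.m+[n∸m]≡n (ℕ.s≤s⁻¹ a<b)))

  det′-equal-columns : ∀ {n} (M : Matrix n) a b → a ≢ b → (∀ i → M i a ≡ M i b) → det′ M ≡ 0#
  det′-equal-columns M a b a≢b Mₐ≡M_b with ℕ.<-cmp (toℕ a) (toℕ b)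
  ... | tri< a<b _ _ = det′-equal-columns< M a b a<b Mₐ≡M_b
  ... | tri≈ _ a≡b _ = ⊥-elim (a≢b (Fin.toℕ-injective a≡b))
  ... | tri> _ _ b<a = det′-equal-columns< M b a b<a (λ i → sym (Mₐ≡M_b i))

  det′-add-column-multiple : ∀ {n} (M : Matrix n) {j k} → j ≢ k → ∀ μ →
    det′ (setColumn M j (λ i → M i j + μ * M i k)) ≡ det′ M
  det′-add-column-multiple {n} M {j} {k} j≢k μ = begin
    det′ (setColumn M j v)   ≡⟨ det′-linear j μ (λ i c c≢j → sym (setColumn-≢ M j v i c≢j))
                                               (λ i c c≢j → trans (setColumn-≢ M j colₖ i c≢j) (sym (setColumn-≢ M j v i c≢j)))
                                               (λ i → trans (setColumn-≡ M j v i) (cong (λ x → M i j + μ * x) (sym (setColumn-≡ M j colₖ i)))) ⟩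
    det′ M + μ * det′ B      ≡⟨ cong (λ d → det′ M + μ * d) B-singular ⟩
    det′ M + μ * 0#          ≡⟨ cong (det′ M +_) (zeroʳ μ) ⟩
    det′ M + 0#              ≡⟨ +-identityʳ (det′ M) ⟩
    det′ M                   ∎
    where
    v colₖ : Vector (Fin p) n
    v i = M i j + μ * M i k
    colₖ i = M i k
    B = setColumn M j colₖ
    B-singular : det′ B ≡ 0#
    B-singular = det′-equal-columns B j k j≢k (λ i → trans (setColumn-≡ M j colₖ i) (sym (setColumn-≢ M j colₖ i (j≢k ∘ sym))))

  addColumnMultiples : ∀ {n} → Matrix n → Fin n → Vector (Fin p) n → Matrix n
  addColumnMultiples M k μ i j = M i j + μ j * M i k

  module ColumnSweep {n} (M : Matrix n) (k : Fin n) (μ : Vector (Fin p) n) (μₖ≡0 : μ k ≡ 0#) where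

    sweep : ℕ → Matrix n
    sweep t i j = if toℕ j ℕ.<ᵇ t then M i j + μ j * M i k else M i j

    sweep-complete : sweep n ≋ addColumnMultiples M k μ
    sweep-complete i j with toℕ j ℕ.<ᵇ n | ℕ.<ᵇ-reflects-< (toℕ j) n
    ... | true  | _        = refl
    ... | false | ofⁿ j≮n  = ⊥-elim (j≮n (Fin.toℕ<n j))

    sweep-pivot : ∀ t i → sweep t i k ≡ M i k
    sweep-pivot t i with toℕ k ℕ.<ᵇ t
    ... | false = refl
    ... | true  = begin
      M i k + μ k * M i k  ≡⟨ cong (λ x → M i k + x * M i k) μₖ≡0 ⟩
      M i k + 0# * M i k   ≡⟨ cong (M i k +_) (zeroˡ (M i k)) ⟩
      M i k + 0#           ≡⟨ +-identityʳ (M i k) ⟩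
      M i k                ∎

    sweep-suc-≢ : ∀ t i j → toℕ j ≢ t → sweep (suc t) i j ≡ sweep t i j
    sweep-suc-≢ t i j j≢t with toℕ j ℕ.<ᵇ suc t | ℕ.<ᵇ-reflects-< (toℕ j) (suc t) | toℕ j ℕ.<ᵇ t | ℕ.<ᵇ-reflects-< (toℕ j) t
    ... | true  | _          | true  | _        = refl
    ... | false | _          | false | _        = refl
    ... | true  | ofʸ j<t+1  | false | ofⁿ j≮t  = ⊥-elim (j≮t (ℕ.≤∧≢⇒< (ℕ.s≤s⁻¹ j<t+1) j≢t))
    ... | false | ofⁿ j≮t+1  | true  | ofʸ j<t  = ⊥-elim (j≮t+1 (ℕ.m<n⇒m<1+n j<t))

    sweep-suc-≡ : ∀ t i j → toℕ j ≡ t → sweep (suc t) i j ≡ sweep t i j + μ j * sweep t i k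
    sweep-suc-≡ t i j refl
      with toℕ j ℕ.<ᵇ suc (toℕ j) | ℕ.<ᵇ-reflects-< (toℕ j) (suc (toℕ j)) | toℕ j ℕ.<ᵇ toℕ j | ℕ.<ᵇ-reflects-< (toℕ j) (toℕ j)
    ... | _     | _          | true  | ofʸ j<j = ⊥-elim (ℕ.<-irrefl refl j<j)
    ... | false | ofⁿ j≮j+1  | false | _       = ⊥-elim (j≮j+1 (ℕ.n<1+n (toℕ j)))
    ... | true  | _          | false | _       = cong (λ x → M i j + μ j * x) (sym (sweep-pivot (toℕ j) i))

    det′-sweep-suc : ∀ t → det′ (sweep (suc t)) ≡ det′ (sweep t)
    det′-sweep-suc t with t ℕ.<? n
    ... | no t≮n = det′-cong (λ i j → sweep-suc-≢ t i j (λ j≡t → t≮n (subst (ℕ._< n) j≡t (Fin.toℕ<n j))))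
    ... | yes t<n with Fin.fromℕ< t<n Fin.≟ k
    ...   | no jₜ≢k  = trans (det′-cong updated) (det′-add-column-multiple (sweep t) jₜ≢k (μ jₜ))
      where
      jₜ = Fin.fromℕ< t<n
      updated : sweep (suc t) ≋ setColumn (sweep t) jₜ (λ i → sweep t i jₜ + μ jₜ * sweep t i k)
      updated i j with j Fin.≟ jₜ
      ... | yes refl = sweep-suc-≡ t i jₜ (Fin.toℕ-fromℕ< t<n)
      ... | no j≢jₜ  = sweep-suc-≢ t i j (λ j≡t → j≢jₜ (Fin.toℕ-injective (trans j≡t (sym (Fin.toℕ-fromℕ< t<n)))))
    ...   | yes jₜ≡k = det′-cong unchanged
      where
      unchanged : sweep (suc t) ≋ sweep t
      unchanged i j with toℕ j ℕ.≟ t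
      ... | no j≢t  = sweep-suc-≢ t i j j≢t
      ... | yes j≡t = subst (λ c → sweep (suc t) i c ≡ sweep t i c)
                            (sym (trans (Fin.toℕ-injective (trans j≡t (sym (Fin.toℕ-fromℕ< t<n)))) jₜ≡k))
                            (trans (sweep-pivot (suc t) i) (sym (sweep-pivot t i)))

    det′-sweep : ∀ t → det′ (sweep t) ≡ det′ M
    det′-sweep zero    = det′-cong {M = sweep zero} {N = M} (λ i j → refl)
    det′-sweep (suc t) = trans (det′-sweep-suc t) (det′-sweep t)

  det′-addColumnMultiples : ∀ {n} (M : Matrix n) k μ → μ k ≡ 0# → det′ (addColumnMultiples M k μ) ≡ det′ M
  det′-addColumnMultiples {n} M k μ μₖ≡0 = trans (det′-cong (λ i j → sym (sweep-complete i j))) (det′-sweep n)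
    where open ColumnSweep M k μ μₖ≡0

module LinearAlgebra (p : ℕ) .{{_ : NonZero p}} (p-prime : Prime p) where

  open PrimeField p
  open Determinant p
  open CommutativeRing +ₚ-*ₚ-commutativeRing
    using (_+_; _*_; -_; 0#; 1#; +-assoc; +-comm; +-identityˡ; +-identityʳ; *-assoc; *-comm; *-identityˡ; *-identityʳ;
           zeroˡ; zeroʳ; distribˡ; distribʳ; -‿inverseʳ; ring; semiring)
  open RingProperties ring using (-‿involutive; -0#≈0#; -‿distribˡ-*; -‿distribʳ-*; -‿+-comm)
  open SemiringSum semiring using (sum; sum-cong-≗; sum-remove; ∑-distrib-+; ∑-comm; *-distribˡ-sum; *-distribʳ-sum)
  open ≡-Reasoning

  -x≡0⇒x≡0 : ∀ {x} → - x ≡ 0# → x ≡ 0#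
  -x≡0⇒x≡0 {x} e = trans (sym (-‿involutive x)) (trans (cong -_ e) -0#≈0#)

  sgn≢0 : ∀ {n} (j : Fin n) → sgn j ≢ 0#
  sgn≢0 j with even (toℕ j)
  ... | true  = 𝟙≢𝟘 p-prime
  ... | false = 𝟙≢𝟘 p-prime ∘ -x≡0⇒x≡0

  sum-neg : ∀ {n} (f : Fin n → Fin p) → sum (λ l → - f l) ≡ - sum f
  sum-neg {zero}  f = sym -0#≈0#
  sum-neg {suc n} f = trans (cong (- f Fin.zero +_) (sum-neg (f ∘ Fin.suc))) (-‿+-comm (f Fin.zero) (sum (f ∘ Fin.suc)))

  infix 7 _∙_
  _∙_ : ∀ {n} → Vector (Fin p) n → Vector (Fin p) n → Fin p
  u ∙ v = sum (λ l → u l * v l)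

  infixr 7 _*ᵥ_
  _*ᵥ_ : ∀ {n} → Matrix n → Vector (Fin p) n → Vector (Fin p) n
  (M *ᵥ x) i = M i ∙ x

  infixl 7 _ᵥ*_
  _ᵥ*_ : ∀ {n} → Vector (Fin p) n → Matrix n → Vector (Fin p) n
  (x ᵥ* M) j = sum (λ i → x i * M i j)

  ∙-congʳ : ∀ {n} (u : Vector (Fin p) n) {v w} → v ≗ w → u ∙ v ≡ u ∙ w
  ∙-congʳ u v≗w = sum-cong-≗ (λ l → cong (u l *_) (v≗w l))

  ∙-zeroʳ : ∀ {n} (u : Vector (Fin p) n) {v} → (∀ l → v l ≡ 0#) → u ∙ v ≡ 0#
  ∙-zeroʳ u v≡0 = sum-zero _ (λ l → trans (cong (u l *_) (v≡0 l)) (zeroʳ (u l)))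

  ∙-zeroˡ : ∀ {n} {u : Vector (Fin p) n} v → (∀ l → u l ≡ 0#) → u ∙ v ≡ 0#
  ∙-zeroˡ v u≡0 = sum-zero _ (λ l → trans (cong (_* v l) (u≡0 l)) (zeroˡ (v l)))

  ᵥ*-∙ : ∀ {n} (u : Vector (Fin p) n) (A : Matrix n) (v : Vector (Fin p) n) → (u ᵥ* A) ∙ v ≡ u ∙ (A *ᵥ v)
  ᵥ*-∙ u A v = begin
    sum (λ k → sum (λ j → u j * A j k) * v k)    ≡⟨ sum-cong-≗ (λ k → *-distribʳ-sum (v k) (λ j → u j * A j k)) ⟩
    sum (λ k → sum (λ j → (u j * A j k) * v k))  ≡⟨ ∑-comm (λ k j → (u j * A j k) * v k) ⟩
    sum (λ j → sum (λ k → (u j * A j k) * v k))  ≡⟨ sum-cong-≗ (λ j → sum-cong-≗ (λ k → *-assoc (u j) (A j k) (v k))) ⟩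
    sum (λ j → sum (λ k → u j * (A j k * v k)))  ≡⟨ sum-cong-≗ (λ j → *-distribˡ-sum (u j) (λ k → A j k * v k)) ⟨
    sum (λ j → u j * sum (λ k → A j k * v k))    ∎

  *ᵥ-insertAt : ∀ {m} (M : Matrix (suc m)) (k : Fin (suc m)) (z : Vector (Fin p) m) c i →
    (M *ᵥ insertAt z k c) i ≡ M i k * c + (λ l → M i (punchIn k l)) ∙ z
  *ᵥ-insertAt M k z c i = trans (sum-remove {i = k} (λ j → M i j * insertAt z k c j))
    (cong₂ _+_ (cong (M i k *_) (Vector.insertAt-lookup z k c))
               (sum-cong-≗ (λ l → cong (M i (punchIn k l) *_) (Vector.insertAt-punchIn z k c l))))

  data Eliminated {n} (M : Matrix n) : Set where
    singular : det′ M ≡ 0# → (z : Vector (Fin p) n) (j : Fin n) → z j ≢ 0# → (∀ i → (M *ᵥ z) i ≡ 0#) → Eliminated M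
    regular  : det′ M ≢ 0# → (∀ (y : Vector (Fin p) n) → ∃ λ x → ∀ i → (M *ᵥ x) i ≡ y i) → Eliminated M

  eliminated-zeroRow : ∀ {m} (M : Matrix (suc m)) → (∀ k → M Fin.zero k ≡ 0#) →
    Eliminated (minor Fin.zero M) → Eliminated M
  eliminated-zeroRow {m} M row₀≡0 rest = kernel rest
    where
    det′≡0 : det′ M ≡ 0#
    det′≡0 = sum-zero (cofactorTerm M) (λ j → cofactorTerm-zero M j (row₀≡0 j))
    kernel : Eliminated (minor Fin.zero M) → Eliminated M
    kernel (singular _ z′ j z′ⱼ≢0 Nz′≡0) = singular det′≡0 z (Fin.suc j) z′ⱼ≢0 Mz≡0
      where
      z : Vector (Fin p) (suc m)
      z = insertAt z′ Fin.zero 0#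
      Mz≡0 : ∀ r → (M *ᵥ z) r ≡ 0#
      Mz≡0 Fin.zero    = ∙-zeroˡ z row₀≡0
      Mz≡0 (Fin.suc r) = begin
        M (Fin.suc r) Fin.zero * 0# + (minor Fin.zero M *ᵥ z′) r  ≡⟨ cong₂ _+_ (zeroʳ (M (Fin.suc r) Fin.zero)) (Nz′≡0 r) ⟩
        0# + 0#                                                   ≡⟨ +-identityˡ 0# ⟩
        0#                                                        ∎
    kernel (regular _ solve) = singular det′≡0 z Fin.zero (𝟙≢𝟘 p-prime) Mz≡0
      where
      -- x expresses the first column through the others, so (1, -x) lies in the kernel
      col₀ x : Vector (Fin p) m
      col₀ r = M (Fin.suc r) Fin.zero
      x = proj₁ (solve col₀)
      z : Vector (Fin p) (suc m)
      z = insertAt (λ l → - x l) Fin.zero 1#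
      Mz≡0 : ∀ r → (M *ᵥ z) r ≡ 0#
      Mz≡0 Fin.zero    = ∙-zeroˡ z row₀≡0
      Mz≡0 (Fin.suc r) = begin
        M (Fin.suc r) Fin.zero * 1# + sum (λ l → M (Fin.suc r) (Fin.suc l) * - x l)
          ≡⟨ cong₂ _+_ (*-identityʳ (M (Fin.suc r) Fin.zero)) (sum-cong-≗ (λ l → sym (-‿distribʳ-* (M (Fin.suc r) (Fin.suc l)) (x l)))) ⟩
        M (Fin.suc r) Fin.zero + sum (λ l → - (M (Fin.suc r) (Fin.suc l) * x l))
          ≡⟨ cong (M (Fin.suc r) Fin.zero +_) (sum-neg (λ l → M (Fin.suc r) (Fin.suc l) * x l)) ⟩
        M (Fin.suc r) Fin.zero + - (minor Fin.zero M *ᵥ x) r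
          ≡⟨ cong (λ y → M (Fin.suc r) Fin.zero + - y) (proj₂ (solve col₀) r) ⟩
        M (Fin.suc r) Fin.zero + - M (Fin.suc r) Fin.zero  ≡⟨ -‿inverseʳ (M (Fin.suc r) Fin.zero) ⟩
        0#                                                 ∎

  𝐈 : ∀ {n} → Matrix n
  𝐈 i j = if does (i Fin.≟ j) then 1# else 0#

  𝐈-diag : ∀ {n} (i : Fin n) → 𝐈 i i ≡ 1#
  𝐈-diag i with i Fin.≟ i
  ... | yes _   = refl
  ... | no i≢i  = ⊥-elim (i≢i refl)

  𝐈-off : ∀ {n} {i j : Fin n} → i ≢ j → 𝐈 i j ≡ 0#
  𝐈-off {i = i} {j} i≢j with i Fin.≟ j
  ... | yes i≡j = ⊥-elim (i≢j i≡j)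
  ... | no _    = refl

  ∙-𝐈ʳ : ∀ {n} (u : Vector (Fin p) n) j → u ∙ (λ l → 𝐈 l j) ≡ u j
  ∙-𝐈ʳ u j = begin
    u ∙ (λ l → 𝐈 l j)  ≡⟨ sum-single _ j (λ l l≢j → trans (cong (u l *_) (𝐈-off l≢j)) (zeroʳ (u l))) ⟩
    u j * 𝐈 j j        ≡⟨ cong (u j *_) (𝐈-diag j) ⟩
    u j * 1#           ≡⟨ *-identityʳ (u j) ⟩
    u j                ∎

  𝐈-∙ˡ : ∀ {n} (u : Vector (Fin p) n) j → 𝐈 j ∙ u ≡ u j
  𝐈-∙ˡ u j = begin
    𝐈 j ∙ u      ≡⟨ sum-single _ j (λ l l≢j → trans (cong (_* u l) (𝐈-off (l≢j ∘ sym))) (zeroˡ (u l))) ⟩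
    𝐈 j j * u j  ≡⟨ cong (_* u j) (𝐈-diag j) ⟩
    1# * u j     ≡⟨ *-identityˡ (u j) ⟩
    u j          ∎

  module Pivot {m} (M : Matrix (suc m)) (k : Fin (suc m)) (a≢0 : M Fin.zero k ≢ 0#) where

    a a⁻¹ : Fin p
    a = M Fin.zero k
    a⁻¹ = proj₁ (*ₚ-inverse p-prime a a≢0)

    a*a⁻¹≡1 : a * a⁻¹ ≡ 1#
    a*a⁻¹≡1 = proj₂ (*ₚ-inverse p-prime a a≢0)

    μ : Vector (Fin p) (suc m)
    μ j = if does (j Fin.≟ k) then 0# else - (M Fin.zero j * a⁻¹)

    -- clearing the first row of M, apart from the pivot, by column operations
    M′ : Matrix (suc m)
    M′ = addColumnMultiples M k μ

    N : Matrix m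
    N = minor k M′

    μₖ≡0 : μ k ≡ 0#
    μₖ≡0 with k Fin.≟ k
    ... | yes _   = refl
    ... | no k≢k  = ⊥-elim (k≢k refl)

    M′₀ⱼ≡0 : ∀ j → j ≢ k → M′ Fin.zero j ≡ 0#
    M′₀ⱼ≡0 j j≢k with j Fin.≟ k
    ... | yes j≡k = ⊥-elim (j≢k j≡k)
    ... | no _    = begin
      M Fin.zero j + - (M Fin.zero j * a⁻¹) * a   ≡⟨ cong (M Fin.zero j +_) (-‿distribˡ-* (M Fin.zero j * a⁻¹) a) ⟨
      M Fin.zero j + - (M Fin.zero j * a⁻¹ * a)   ≡⟨ cong (λ x → M Fin.zero j + - x) (*-assoc (M Fin.zero j) a⁻¹ a) ⟩
      M Fin.zero j + - (M Fin.zero j * (a⁻¹ * a)) ≡⟨ cong (λ x → M Fin.zero j + - (M Fin.zero j * x)) (trans (*-comm a⁻¹ a) a*a⁻¹≡1) ⟩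
      M Fin.zero j + - (M Fin.zero j * 1#)        ≡⟨ cong (λ x → M Fin.zero j + - x) (*-identityʳ (M Fin.zero j)) ⟩
      M Fin.zero j + - M Fin.zero j               ≡⟨ -‿inverseʳ (M Fin.zero j) ⟩
      0#                                          ∎

    M′ᵢₖ≡Mᵢₖ : ∀ i → M′ i k ≡ M i k
    M′ᵢₖ≡Mᵢₖ i = begin
      M i k + μ k * M i k  ≡⟨ cong (λ x → M i k + x * M i k) μₖ≡0 ⟩
      M i k + 0# * M i k   ≡⟨ cong (M i k +_) (zeroˡ (M i k)) ⟩
      M i k + 0#           ≡⟨ +-identityʳ (M i k) ⟩
      M i k                ∎

    det′M≡ : det′ M ≡ sgn k * (a * det′ N)
    det′M≡ = begin
      det′ M                             ≡⟨ det′-addColumnMultiples M k μ μₖ≡0 ⟨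
      det′ M′                            ≡⟨ sum-single (cofactorTerm M′) k (λ j j≢k → cofactorTerm-zero M′ j (M′₀ⱼ≡0 j j≢k)) ⟩
      sgn k * (M′ Fin.zero k * det′ N)   ≡⟨ cong (λ x → sgn k * (x * det′ N)) (M′ᵢₖ≡Mᵢₖ Fin.zero) ⟩
      sgn k * (a * det′ N)               ∎

    M′-row₀-off-pivot : ∀ z → (λ l → M′ Fin.zero (punchIn k l)) ∙ z ≡ 0#
    M′-row₀-off-pivot z = ∙-zeroˡ z (λ l → M′₀ⱼ≡0 (punchIn k l) (Fin.punchInᵢ≢i k l))

    substitute : Vector (Fin p) (suc m) → Vector (Fin p) (suc m)
    substitute x j = x j + 𝐈 k j * (μ ∙ x)

    *ᵥ-substitute : ∀ x i → (M *ᵥ substitute x) i ≡ (M′ *ᵥ x) i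
    *ᵥ-substitute x i = begin
      sum (λ j → M i j * (x j + 𝐈 k j * s))               ≡⟨ sum-cong-≗ (λ j → distribˡ (M i j) (x j) (𝐈 k j * s)) ⟩
      sum (λ j → M i j * x j + M i j * (𝐈 k j * s))       ≡⟨ ∑-distrib-+ (λ j → M i j * x j) (λ j → M i j * (𝐈 k j * s)) ⟩
      (M *ᵥ x) i + sum (λ j → M i j * (𝐈 k j * s))        ≡⟨ cong ((M *ᵥ x) i +_) pivot-column ⟩
      (M *ᵥ x) i + M i k * s                              ≡⟨ cong ((M *ᵥ x) i +_) (*-distribˡ-sum (M i k) (λ j → μ j * x j)) ⟩
      (M *ᵥ x) i + sum (λ j → M i k * (μ j * x j))        ≡⟨ cong ((M *ᵥ x) i +_) (sum-cong-≗ (λ j → rearrange (M i k) (μ j) (x j))) ⟩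
      (M *ᵥ x) i + sum (λ j → (μ j * M i k) * x j)        ≡⟨ ∑-distrib-+ (λ j → M i j * x j) (λ j → (μ j * M i k) * x j) ⟨
      sum (λ j → M i j * x j + (μ j * M i k) * x j)       ≡⟨ sum-cong-≗ (λ j → distribʳ (x j) (M i j) (μ j * M i k)) ⟨
      (M′ *ᵥ x) i                                         ∎
      where
      s = μ ∙ x
      rearrange : ∀ b c d → b * (c * d) ≡ (c * b) * d
      rearrange b c d = trans (sym (*-assoc b c d)) (cong (_* d) (*-comm b c))
      pivot-column : sum (λ j → M i j * (𝐈 k j * s)) ≡ M i k * s
      pivot-column = begin
        sum (λ j → M i j * (𝐈 k j * s))  ≡⟨ sum-cong-≗ (λ j → rearrange (M i j) (𝐈 k j) s) ⟩
        sum (λ j → (𝐈 k j * M i j) * s)  ≡⟨ *-distribʳ-sum s (λ j → 𝐈 k j * M i j) ⟨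
        (𝐈 k ∙ (λ j → M i j)) * s        ≡⟨ cong (_* s) (𝐈-∙ˡ (λ j → M i j) k) ⟩
        M i k * s                        ∎

    lift-kernel : ∀ (z : Vector (Fin p) m) → (∀ i → (N *ᵥ z) i ≡ 0#) → ∀ i → (M *ᵥ substitute (insertAt z k 0#)) i ≡ 0#
    lift-kernel z Nz≡0 r = begin
      (M *ᵥ substitute (insertAt z k 0#)) r            ≡⟨ *ᵥ-substitute (insertAt z k 0#) r ⟩
      (M′ *ᵥ insertAt z k 0#) r                        ≡⟨ *ᵥ-insertAt M′ k z 0# r ⟩
      M′ r k * 0# + (λ l → M′ r (punchIn k l)) ∙ z     ≡⟨ cong₂ _+_ (zeroʳ (M′ r k)) (rest r) ⟩
      0# + 0#                                          ≡⟨ +-identityˡ 0# ⟩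
      0#                                               ∎
      where
      rest : ∀ r → (λ l → M′ r (punchIn k l)) ∙ z ≡ 0#
      rest Fin.zero    = M′-row₀-off-pivot z
      rest (Fin.suc r) = Nz≡0 r

    lift-kernel-nonzero : ∀ (z : Vector (Fin p) m) j → z j ≢ 0# → substitute (insertAt z k 0#) (punchIn k j) ≢ 0#
    lift-kernel-nonzero z j zⱼ≢0 e = zⱼ≢0 (begin
      z j                                ≡⟨ Vector.insertAt-punchIn z k 0# j ⟨
      z′ (punchIn k j)                   ≡⟨ +-identityʳ (z′ (punchIn k j)) ⟨
      z′ (punchIn k j) + 0#              ≡⟨ cong (z′ (punchIn k j) +_) (zeroˡ (μ ∙ z′)) ⟨
      z′ (punchIn k j) + 0# * (μ ∙ z′)   ≡⟨ cong (λ x → z′ (punchIn k j) + x * (μ ∙ z′)) (𝐈-off (Fin.punchInᵢ≢i k j ∘ sym)) ⟨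
      substitute z′ (punchIn k j)        ≡⟨ e ⟩
      0#                                 ∎)
      where
      z′ = insertAt z k 0#

    lift-solution : (∀ (y′ : Vector (Fin p) m) → ∃ λ z → ∀ i → (N *ᵥ z) i ≡ y′ i) →
                    ∀ (y : Vector (Fin p) (suc m)) → ∃ λ x → ∀ i → (M *ᵥ x) i ≡ y i
    lift-solution solveN y = substitute (insertAt z k zₖ) , λ r →
      trans (*ᵥ-substitute (insertAt z k zₖ) r) (trans (*ᵥ-insertAt M′ k z zₖ r) (solves r))
      where
      zₖ : Fin p
      zₖ = a⁻¹ * y Fin.zero
      w y′ z : Vector (Fin p) m
      w r = M′ (Fin.suc r) k
      y′ r = y (Fin.suc r) + - (zₖ * w r)
      z = proj₁ (solveN y′)
      solves : ∀ r → M′ r k * zₖ + (λ l → M′ r (punchIn k l)) ∙ z ≡ y r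
      solves Fin.zero = begin
        M′ Fin.zero k * zₖ + (λ l → M′ Fin.zero (punchIn k l)) ∙ z ≡⟨ cong₂ _+_ (cong (_* zₖ) (M′ᵢₖ≡Mᵢₖ Fin.zero)) (M′-row₀-off-pivot z) ⟩
        a * (a⁻¹ * y Fin.zero) + 0#                              ≡⟨ +-identityʳ (a * (a⁻¹ * y Fin.zero)) ⟩
        a * (a⁻¹ * y Fin.zero)                                   ≡⟨ *-assoc a a⁻¹ (y Fin.zero) ⟨
        (a * a⁻¹) * y Fin.zero                                   ≡⟨ cong (_* y Fin.zero) a*a⁻¹≡1 ⟩
        1# * y Fin.zero                                          ≡⟨ *-identityˡ (y Fin.zero) ⟩
        y Fin.zero                                               ∎
      solves (Fin.suc r) = begin
        w r * zₖ + (N *ᵥ z) r                        ≡⟨ cong (w r * zₖ +_) (proj₂ (solveN y′) r) ⟩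
        w r * zₖ + (y (Fin.suc r) + - (zₖ * w r))    ≡⟨ cong (λ x → w r * zₖ + (y (Fin.suc r) + - x)) (*-comm zₖ (w r)) ⟩
        w r * zₖ + (y (Fin.suc r) + - (w r * zₖ))    ≡⟨ cong (w r * zₖ +_) (+-comm (y (Fin.suc r)) (- (w r * zₖ))) ⟩
        w r * zₖ + (- (w r * zₖ) + y (Fin.suc r))    ≡⟨ +-assoc (w r * zₖ) (- (w r * zₖ)) (y (Fin.suc r)) ⟨
        (w r * zₖ + - (w r * zₖ)) + y (Fin.suc r)    ≡⟨ cong (_+ y (Fin.suc r)) (-‿inverseʳ (w r * zₖ)) ⟩
        0# + y (Fin.suc r)                           ≡⟨ +-identityˡ (y (Fin.suc r)) ⟩
        y (Fin.suc r)                                ∎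

    eliminated : Eliminated N → Eliminated M
    eliminated (singular det′N≡0 z j zⱼ≢0 Nz≡0) =
      singular det′M≡0 (substitute (insertAt z k 0#)) (punchIn k j) (lift-kernel-nonzero z j zⱼ≢0) (lift-kernel z Nz≡0)
      where
      det′M≡0 : det′ M ≡ 0#
      det′M≡0 = begin
        det′ M                ≡⟨ det′M≡ ⟩
        sgn k * (a * det′ N)  ≡⟨ cong (λ d → sgn k * (a * d)) det′N≡0 ⟩
        sgn k * (a * 0#)      ≡⟨ cong (sgn k *_) (zeroʳ a) ⟩
        sgn k * 0#            ≡⟨ zeroʳ (sgn k) ⟩
        0#                    ∎
    eliminated (regular det′N≢0 solveN) = regular det′M≢0 (lift-solution solveN)
      where
      det′M≢0 : det′ M ≢ 0#
      det′M≢0 e = *ₚ≢𝟘 p-prime (sgn≢0 k) (*ₚ≢𝟘 p-prime a≢0 det′N≢0) (trans (sym det′M≡) e)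

  eliminate : ∀ {n} (M : Matrix n) → Eliminated M
  eliminate {zero}  M = regular (𝟙≢𝟘 p-prime) (λ y → y , λ ())
  eliminate {suc m} M with Fin.all? (λ k → M Fin.zero k Fin.≟ 0#)
  ... | yes row₀≡0 = eliminated-zeroRow M row₀≡0 (eliminate (minor Fin.zero M))
  ... | no row₀≢0 with Fin.¬∀⟶∃¬ (suc m) (λ k → M Fin.zero k ≡ 0#) (λ k → M Fin.zero k Fin.≟ 0#) row₀≢0
  ...   | k , a≢0 = Pivot.eliminated M k a≢0 (eliminate (Pivot.N M k a≢0))

  infixl 7 _*ₘ_
  _*ₘ_ : ∀ {n} → Matrix n → Matrix n → Matrix n
  (A *ₘ B) i k = A i ∙ (λ j → B j k)

  *ₘ-*ᵥ : ∀ {n} (A B : Matrix n) c i → ((A *ₘ B) *ᵥ c) i ≡ (A *ᵥ B *ᵥ c) i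
  *ₘ-*ᵥ A B c i = ᵥ*-∙ (A i) B c

  ᵥ*-*ₘ : ∀ {n} (c : Vector (Fin p) n) (A B : Matrix n) j → (c ᵥ* (A *ₘ B)) j ≡ (c ᵥ* A ᵥ* B) j
  ᵥ*-*ₘ c A B j = sym (ᵥ*-∙ c A (λ k → B k j))

  *ₘ-assoc : ∀ {n} (A B C : Matrix n) → (A *ₘ B) *ₘ C ≋ A *ₘ (B *ₘ C)
  *ₘ-assoc A B C i l = *ₘ-*ᵥ A B (λ k → C k l) i

  *ₘ-identityʳ : ∀ {n} (A : Matrix n) → A *ₘ 𝐈 ≋ A
  *ₘ-identityʳ A i = ∙-𝐈ʳ (A i)

  *ₘ-identityˡ : ∀ {n} (A : Matrix n) → 𝐈 *ₘ A ≋ A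
  *ₘ-identityˡ A i j = 𝐈-∙ˡ (λ k → A k j) i

  *ₘ-congˡ : ∀ {n} {A B : Matrix n} (C : Matrix n) → A ≋ B → A *ₘ C ≋ B *ₘ C
  *ₘ-congˡ C A≋B i k = sum-cong-≗ (λ j → cong (_* C j k) (A≋B i j))

  *ₘ-congʳ : ∀ {n} (C : Matrix n) {A B : Matrix n} → A ≋ B → C *ₘ A ≋ C *ₘ B
  *ₘ-congʳ C A≋B i k = ∙-congʳ (C i) (λ j → A≋B j k)

  ≋-trans : ∀ {n} {A B C : Matrix n} → A ≋ B → B ≋ C → A ≋ C
  ≋-trans A≋B B≋C i j = trans (A≋B i j) (B≋C i j)

  ≋-sym : ∀ {n} {A B : Matrix n} → A ≋ B → B ≋ A
  ≋-sym A≋B i j = sym (A≋B i j)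

  Invertibleᶠ : ∀ {n} → Matrix n → Set
  Invertibleᶠ {n} M = ∃ λ (B : Matrix n) → M *ₘ B ≋ 𝐈 × B *ₘ M ≋ 𝐈

  Nonsingularᶠ : ∀ {n} → Matrix n → Set
  Nonsingularᶠ M = det′ M ≢ 0#

  KernelTrivial : ∀ {n} → Matrix n → Set
  KernelTrivial M = ∀ z → (∀ i → (M *ᵥ z) i ≡ 0#) → ∀ j → z j ≡ 0#

  kernelTrivial⇒nonsingular : ∀ {n} {M : Matrix n} → KernelTrivial M → Nonsingularᶠ M
  kernelTrivial⇒nonsingular {M = M} trivial with eliminate M
  ... | singular _ z j zⱼ≢0 Mz≡0 = ⊥-elim (zⱼ≢0 (trivial z Mz≡0 j))
  ... | regular det′≢0 _         = det′≢0

  nonsingular⇒surjective : ∀ {n} {M : Matrix n} → Nonsingularᶠ M → ∀ y → ∃ λ x → ∀ i → (M *ᵥ x) i ≡ y i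
  nonsingular⇒surjective {M = M} det′≢0 with eliminate M
  ... | singular det′≡0 _ _ _ _ = ⊥-elim (det′≢0 det′≡0)
  ... | regular _ solve         = solve

  rightInverse⇒kernelTrivial : ∀ {n} {M B : Matrix n} → M *ₘ B ≋ 𝐈 → KernelTrivial B
  rightInverse⇒kernelTrivial {M = M} {B} MB≋𝐈 z Bz≡0 j = begin
    z j                  ≡⟨ 𝐈-∙ˡ z j ⟨
    (𝐈 *ᵥ z) j           ≡⟨ sum-cong-≗ (λ l → cong (_* z l) (MB≋𝐈 j l)) ⟨
    ((M *ₘ B) *ᵥ z) j    ≡⟨ *ₘ-*ᵥ M B z j ⟩
    (M *ᵥ B *ᵥ z) j      ≡⟨ ∙-zeroʳ (M j) Bz≡0 ⟩
    0#                   ∎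

  invertible⇒nonsingular : ∀ {n} {M : Matrix n} → Invertibleᶠ M → Nonsingularᶠ M
  invertible⇒nonsingular {M = M} (B , _ , BM≋𝐈) = kernelTrivial⇒nonsingular (rightInverse⇒kernelTrivial {M = B} {B = M} BM≋𝐈)

  nonsingular⇒rightInverse : ∀ {n} {M : Matrix n} → Nonsingularᶠ M → ∃ λ B → M *ₘ B ≋ 𝐈
  nonsingular⇒rightInverse {M = M} det′≢0 = (λ i j → proj₁ (solve j) i) , (λ i j → proj₂ (solve j) i)
    where
    solve : ∀ j → ∃ λ x → ∀ i → (M *ᵥ x) i ≡ 𝐈 i j
    solve j = nonsingular⇒surjective det′≢0 (λ l → 𝐈 l j)

  -- a right inverse B of M is nonsingular; if C is a right inverse of B then C = (MB)C = M(BC) = M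
  nonsingular⇒invertible : ∀ {n} {M : Matrix n} → Nonsingularᶠ M → Invertibleᶠ M
  nonsingular⇒invertible {M = M} det′≢0 with nonsingular⇒rightInverse det′≢0
  ... | B , MB≋𝐈 with nonsingular⇒rightInverse {M = B} (kernelTrivial⇒nonsingular (rightInverse⇒kernelTrivial {M = M} {B = B} MB≋𝐈))
  ...   | C , BC≋𝐈 = B , MB≋𝐈 , ≋-trans (*ₘ-congʳ B (≋-sym C≋M)) BC≋𝐈
    where
    C≋M : C ≋ M
    C≋M = ≋-trans (≋-sym (*ₘ-identityˡ C)) (≋-trans (*ₘ-congˡ C (≋-sym MB≋𝐈))
            (≋-trans (*ₘ-assoc M B C) (≋-trans (*ₘ-congʳ M BC≋𝐈) (*ₘ-identityʳ M))))

  invertible⇒kernelTrivial : ∀ {n} {M : Matrix n} → Invertibleᶠ M → KernelTrivial M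
  invertible⇒kernelTrivial {M = M} (B , _ , BM≋𝐈) = rightInverse⇒kernelTrivial {M = B} {B = M} BM≋𝐈

  kernel-orthogonal⇒nonsingular : ∀ {n} {M : Matrix n} →
    (∀ y z → (∀ i → (M *ᵥ z) i ≡ 0#) → y ∙ z ≡ 0#) → Nonsingularᶠ M
  kernel-orthogonal⇒nonsingular orthogonal = kernelTrivial⇒nonsingular λ z Mz≡0 j →
    trans (sym (𝐈-∙ˡ z j)) (orthogonal (𝐈 j) z Mz≡0)

  RowsIn : ∀ {n} → Matrix n → Matrix n → Set
  RowsIn {n} M N = ∀ i → ∃ λ i′ → ∀ j → M i j ≡ N i′ j

  nonsingular-rowsIn : ∀ {n} {M N : Matrix n} → RowsIn M N → Nonsingularᶠ M → Nonsingularᶠ N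
  nonsingular-rowsIn {M = M} {N} M⊆N det′M≢0 = kernelTrivial⇒nonsingular λ z Nz≡0 →
    invertible⇒kernelTrivial (nonsingular⇒invertible det′M≢0) z λ i →
      trans (sum-cong-≗ (λ j → cong (_* z j) (proj₂ (M⊆N i) j))) (Nz≡0 (proj₁ (M⊆N i)))

  invertible⇒ᵥ*-injective : ∀ {n} {M : Matrix n} → Invertibleᶠ M →
    ∀ c d → (∀ j → (c ᵥ* M) j ≡ (d ᵥ* M) j) → ∀ i → c i ≡ d i
  invertible⇒ᵥ*-injective {M = M} (B , MB≋𝐈 , _) c d cM≡dM i = begin
    c i                ≡⟨ ∙-𝐈ʳ c i ⟨
    (c ᵥ* 𝐈) i         ≡⟨ ∙-congʳ c (λ l → MB≋𝐈 l i) ⟨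
    (c ᵥ* (M *ₘ B)) i  ≡⟨ ᵥ*-*ₘ c M B i ⟩
    (c ᵥ* M ᵥ* B) i    ≡⟨ sum-cong-≗ (λ l → cong (_* B l i) (cM≡dM l)) ⟩
    (d ᵥ* M ᵥ* B) i    ≡⟨ ᵥ*-*ₘ d M B i ⟨
    (d ᵥ* (M *ₘ B)) i  ≡⟨ ∙-congʳ d (λ l → MB≋𝐈 l i) ⟩
    (d ᵥ* 𝐈) i         ≡⟨ ∙-𝐈ʳ d i ⟩
    d i                ∎

  nonsingular⇒ᵥ*-injective : ∀ {n} {M : Matrix n} → Nonsingularᶠ M →
    ∀ c d → (∀ j → (c ᵥ* M) j ≡ (d ᵥ* M) j) → ∀ i → c i ≡ d i
  nonsingular⇒ᵥ*-injective det′≢0 = invertible⇒ᵥ*-injective (nonsingular⇒invertible det′≢0)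

  invertible⇒ᵥ*-surjective : ∀ {n} {M : Matrix n} → Invertibleᶠ M → ∀ y → ∃ λ x → ∀ j → (x ᵥ* M) j ≡ y j
  invertible⇒ᵥ*-surjective {M = M} (B , _ , BM≋𝐈) y = y ᵥ* B , λ j → begin
    (y ᵥ* B ᵥ* M) j    ≡⟨ ᵥ*-*ₘ y B M j ⟨
    (y ᵥ* (B *ₘ M)) j  ≡⟨ ∙-congʳ y (λ l → BM≋𝐈 l j) ⟩
    (y ᵥ* 𝐈) j         ≡⟨ ∙-𝐈ʳ y j ⟩
    y j                ∎

  nonsingular⇒ᵥ*-surjective : ∀ {n} {M : Matrix n} → Nonsingularᶠ M → ∀ y → ∃ λ x → ∀ j → (x ᵥ* M) j ≡ y j
  nonsingular⇒ᵥ*-surjective det′≢0 = invertible⇒ᵥ*-surjective (nonsingular⇒invertible det′≢0)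

  ᵥ*-surjective⇒nonsingular : ∀ {n} {M : Matrix n} → (∀ y → ∃ λ x → ∀ j → (x ᵥ* M) j ≡ y j) → Nonsingularᶠ M
  ᵥ*-surjective⇒nonsingular {M = M} surjective = kernel-orthogonal⇒nonsingular λ y z Mz≡0 →
    let (x , xM≡y) = surjective y in begin
      y ∙ z            ≡⟨ sum-cong-≗ (λ l → cong (_* z l) (xM≡y l)) ⟨
      (x ᵥ* M) ∙ z     ≡⟨ ᵥ*-∙ x M z ⟩
      x ∙ (M *ᵥ z)     ≡⟨ ∙-zeroʳ x Mz≡0 ⟩
      0#               ∎

  nonsingular⇒rows-injective : ∀ {n} {M : Matrix n} → Nonsingularᶠ M → ∀ i i′ → (∀ j → M i j ≡ M i′ j) → i ≡ i′
  nonsingular⇒rows-injective {M = M} det′≢0 i i′ Mᵢ≡Mᵢ′ with i′ Fin.≟ i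
  ... | yes i′≡i = sym i′≡i
  ... | no i′≢i  = ⊥-elim (𝟙≢𝟘 p-prime (begin
    1#         ≡⟨ 𝐈-diag i ⟨
    𝐈 i i      ≡⟨ nonsingular⇒ᵥ*-injective det′≢0 (𝐈 i) (𝐈 i′) 𝐈ᵢM≡𝐈ᵢ′M i ⟩
    𝐈 i′ i     ≡⟨ 𝐈-off i′≢i ⟩
    0#         ∎))
    where
    𝐈ᵢM≡𝐈ᵢ′M : ∀ j → (𝐈 i ᵥ* M) j ≡ (𝐈 i′ ᵥ* M) j
    𝐈ᵢM≡𝐈ᵢ′M j = trans (𝐈-∙ˡ (λ l → M l j) i) (trans (Mᵢ≡Mᵢ′ j) (sym (𝐈-∙ˡ (λ l → M l j) i′)))

  ⟦⟧-injective : ∀ {n} {A B : Mat p n} → ⟦ A ⟧ ≋ ⟦ B ⟧ → A ≡ B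
  ⟦⟧-injective A≋B = lookup-ext (λ i → lookup-ext (A≋B i))

  toMat : ∀ {n} → Matrix n → Mat p n
  toMat B = tabulate (tabulate ∘ B)

  ⟦toMat⟧ : ∀ {n} (B : Matrix n) → ⟦ toMat B ⟧ ≋ B
  ⟦toMat⟧ B i j = trans (cong (λ row → lookup row j) (Vec.lookup∘tabulate _ i)) (Vec.lookup∘tabulate _ j)

  ⟦·⟧ : ∀ {n} (A B : Mat p n) → ⟦ A · B ⟧ ≋ ⟦ A ⟧ *ₘ ⟦ B ⟧
  ⟦·⟧ A B i j = trans (⟦toMat⟧ (λ i j → sumₚ (λ k → ⟦ A ⟧ i k * ⟦ B ⟧ k j)) i j) (sumₚ≡sum (λ k → ⟦ A ⟧ i k * ⟦ B ⟧ k j))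

  ⟦I⟧ : ∀ {n} → ⟦ I {p} {n} ⟧ ≋ 𝐈
  ⟦I⟧ = ⟦toMat⟧ 𝐈

  ·-assoc : ∀ {n} (A B C : Mat p n) → A · (B · C) ≡ (A · B) · C
  ·-assoc A B C = ⟦⟧-injective (λ i j → begin
    ⟦ A · (B · C) ⟧ i j              ≡⟨ ⟦·⟧ A (B · C) i j ⟩
    (⟦ A ⟧ *ₘ ⟦ B · C ⟧) i j         ≡⟨ *ₘ-congʳ ⟦ A ⟧ (⟦·⟧ B C) i j ⟩
    (⟦ A ⟧ *ₘ (⟦ B ⟧ *ₘ ⟦ C ⟧)) i j  ≡⟨ *ₘ-assoc ⟦ A ⟧ ⟦ B ⟧ ⟦ C ⟧ i j ⟨
    (⟦ A ⟧ *ₘ ⟦ B ⟧ *ₘ ⟦ C ⟧) i j    ≡⟨ *ₘ-congˡ ⟦ C ⟧ (⟦·⟧ A B) i j ⟨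
    (⟦ A · B ⟧ *ₘ ⟦ C ⟧) i j         ≡⟨ ⟦·⟧ (A · B) C i j ⟨
    ⟦ (A · B) · C ⟧ i j              ∎)

  ·-identityʳ : ∀ {n} (A : Mat p n) → A · I ≡ A
  ·-identityʳ A = ⟦⟧-injective (≋-trans (⟦·⟧ A I) (≋-trans (*ₘ-congʳ ⟦ A ⟧ ⟦I⟧) (*ₘ-identityʳ ⟦ A ⟧)))

  Invertible⇒nonsingular : ∀ {n} {A : Mat p n} → Invertible A → Nonsingularᶠ ⟦ A ⟧
  Invertible⇒nonsingular {A = A} (B , AB≡I , BA≡I) = invertible⇒nonsingular
    (⟦ B ⟧ , ≋-trans (≋-sym (⟦·⟧ A B)) (≋-trans (λ i j → cong (λ X → ⟦ X ⟧ i j) AB≡I) ⟦I⟧)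
           , ≋-trans (≋-sym (⟦·⟧ B A)) (≋-trans (λ i j → cong (λ X → ⟦ X ⟧ i j) BA≡I) ⟦I⟧))

  invertible⇒Invertible : ∀ {n} {A : Mat p n} → Invertibleᶠ ⟦ A ⟧ → Invertible A
  invertible⇒Invertible {A = A} (B , AB≋𝐈 , BA≋𝐈) = toMat B
    , ⟦⟧-injective (≋-trans (⟦·⟧ A (toMat B)) (≋-trans (*ₘ-congʳ ⟦ A ⟧ (⟦toMat⟧ B)) (≋-trans AB≋𝐈 (≋-sym ⟦I⟧))))
    , ⟦⟧-injective (≋-trans (⟦·⟧ (toMat B) A) (≋-trans (*ₘ-congˡ ⟦ A ⟧ (⟦toMat⟧ B)) (≋-trans BA≋𝐈 (≋-sym ⟦I⟧))))

  nonsingular⇒Invertible : ∀ {n} {A : Mat p n} → Nonsingularᶠ ⟦ A ⟧ → Invertible A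
  nonsingular⇒Invertible {A = A} det′≢0 = invertible⇒Invertible {A = A} (nonsingular⇒invertible det′≢0)

toℕ-mod : ∀ x k .{{_ : NonZero k}} → toℕ (x mod k) ≡ x % k
toℕ-mod x k = Fin.toℕ-fromℕ< _

%-idemˡ-+ : ∀ a b n .{{_ : NonZero n}} → (a % n ℕ.+ b) % n ≡ (a ℕ.+ b) % n
%-idemˡ-+ a b n = begin
  (a % n ℕ.+ b) % n              ≡⟨ %-distribˡ-+ (a % n) b n ⟩
  (a % n % n ℕ.+ b % n) % n      ≡⟨ cong (λ x → (x ℕ.+ b % n) % n) (m%n%n≡m%n a n) ⟩
  (a % n ℕ.+ b % n) % n          ≡⟨ %-distribˡ-+ a b n ⟨
  (a ℕ.+ b) % n                  ∎
  where open ≡-Reasoning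

module CyclicIndex where

  open ≡-Reasoning

  cpred : ∀ {m} → Fin (suc m) → Fin (suc m)
  cpred {m} Fin.zero    = Fin.fromℕ m
  cpred     (Fin.suc j) = inject₁ j

  toℕ-cpred : ∀ {m} (j : Fin (suc m)) → toℕ (cpred j) ≡ (toℕ j ℕ.+ m) % suc m
  toℕ-cpred {m} Fin.zero = trans (Fin.toℕ-fromℕ m) (sym (m<n⇒m%n≡m (ℕ.n<1+n m)))
  toℕ-cpred {suc m} (Fin.suc j) = begin
    toℕ (inject₁ j)                         ≡⟨ Fin.toℕ-inject₁ j ⟩
    toℕ j                                   ≡⟨ m<n⇒m%n≡m (ℕ.<-trans (Fin.toℕ<n j) (ℕ.n<1+n (suc m))) ⟨
    toℕ j % suc (suc m)                     ≡⟨ [m+n]%n≡m%n (toℕ j) (suc (suc m)) ⟨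
    (toℕ j ℕ.+ suc (suc m)) % suc (suc m)   ≡⟨ cong (_% suc (suc m)) (ℕ.+-suc (toℕ j) (suc m)) ⟩
    (suc (toℕ j) ℕ.+ suc m) % suc (suc m)   ∎

  module _ {p : ℕ} .{{_ : NonZero p}} where

    toℕ-csuc : ∀ {m} (i : Fin (suc m)) → toℕ (csuc {p} i) ≡ suc (toℕ i) % suc m
    toℕ-csuc i = Fin.toℕ-fromℕ< _

    csuc-cpred : ∀ {m} (j : Fin (suc m)) → csuc {p} (cpred j) ≡ j
    csuc-cpred {m} j = Fin.toℕ-injective (begin
      toℕ (csuc {p} (cpred j))                 ≡⟨ toℕ-csuc (cpred j) ⟩
      (1 ℕ.+ toℕ (cpred j)) % suc m            ≡⟨ cong (λ x → (1 ℕ.+ x) % suc m) (toℕ-cpred j) ⟩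
      (1 ℕ.+ (toℕ j ℕ.+ m) % suc m) % suc m    ≡⟨ cong (_% suc m) (ℕ.+-comm 1 _) ⟩
      ((toℕ j ℕ.+ m) % suc m ℕ.+ 1) % suc m    ≡⟨ %-idemˡ-+ (toℕ j ℕ.+ m) 1 (suc m) ⟩
      (toℕ j ℕ.+ m ℕ.+ 1) % suc m              ≡⟨ cong (_% suc m) (trans (ℕ.+-assoc (toℕ j) m 1) (cong (toℕ j ℕ.+_) (ℕ.+-comm m 1))) ⟩
      (toℕ j ℕ.+ suc m) % suc m                ≡⟨ [m+n]%n≡m%n (toℕ j) (suc m) ⟩
      toℕ j % suc m                            ≡⟨ m<n⇒m%n≡m (Fin.toℕ<n j) ⟩
      toℕ j                                    ∎)

    cpred-csuc : ∀ {m} (k : Fin (suc m)) → cpred (csuc {p} k) ≡ k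
    cpred-csuc {m} k = Fin.toℕ-injective (begin
      toℕ (cpred (csuc {p} k))                 ≡⟨ toℕ-cpred (csuc k) ⟩
      (toℕ (csuc {p} k) ℕ.+ m) % suc m         ≡⟨ cong (λ x → (x ℕ.+ m) % suc m) (toℕ-csuc k) ⟩
      (suc (toℕ k) % suc m ℕ.+ m) % suc m      ≡⟨ %-idemˡ-+ (suc (toℕ k)) m (suc m) ⟩
      (suc (toℕ k) ℕ.+ m) % suc m              ≡⟨ cong (_% suc m) (sym (ℕ.+-suc (toℕ k) m)) ⟩
      (toℕ k ℕ.+ suc m) % suc m                ≡⟨ [m+n]%n≡m%n (toℕ k) (suc m) ⟩
      toℕ k % suc m                            ≡⟨ m<n⇒m%n≡m (Fin.toℕ<n k) ⟩
      toℕ k                                    ∎)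

module Rotations {A : Set} where

  open CyclicIndex
  open ≡-Reasoning

  lookup-last : ∀ {m} (w : Vec A (suc m)) → Vec.last w ≡ lookup w (Fin.fromℕ m)
  lookup-last (x ∷ [])     = refl
  lookup-last (x ∷ y ∷ xs) = lookup-last (y ∷ xs)

  lookup-init : ∀ {m} (w : Vec A (suc m)) j → lookup (Vec.init w) j ≡ lookup w (inject₁ j)
  lookup-init (x ∷ y ∷ xs) Fin.zero    = refl
  lookup-init (x ∷ y ∷ xs) (Fin.suc j) = lookup-init (y ∷ xs) j

  lookup-shift : ∀ {m} (w : Vec A (suc m)) j → lookup (shift w) j ≡ lookup w (cpred j)
  lookup-shift (x ∷ xs) Fin.zero    = lookup-last (x ∷ xs)
  lookup-shift (x ∷ xs) (Fin.suc j) = lookup-init (x ∷ xs) j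
    where open ≡-Reasoning

  rot-shift : ∀ {n} k (w : Vec A n) → rot k (shift w) ≡ shift (rot k w)
  rot-shift zero    w = refl
  rot-shift (suc k) w = cong shift (rot-shift k w)

  rot-+ : ∀ {n} a b (w : Vec A n) → rot (a ℕ.+ b) w ≡ rot a (rot b w)
  rot-+ zero    b w = refl
  rot-+ (suc a) b w = cong shift (rot-+ a b w)

  -- σᵏ moves entry i to position i + k (mod m+1); k·m ≡ -k (mod m+1)
  lookup-rot : ∀ {m} k (w : Vec A (suc m)) j → lookup (rot k w) j ≡ lookup w ((toℕ j ℕ.+ k ℕ.* m) mod suc m)
  lookup-rot {m} zero w j = cong (lookup w) (Fin.toℕ-injective (begin
    toℕ j                              ≡⟨ m<n⇒m%n≡m (Fin.toℕ<n j) ⟨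
    toℕ j % suc m                      ≡⟨ cong (_% suc m) (ℕ.+-identityʳ (toℕ j)) ⟨
    (toℕ j ℕ.+ 0) % suc m              ≡⟨ Fin.toℕ-fromℕ< _ ⟨
    toℕ ((toℕ j ℕ.+ 0) mod suc m)      ∎))
  lookup-rot {m} (suc k) w j = begin
    lookup (shift (rot k w)) j                          ≡⟨ lookup-shift (rot k w) j ⟩
    lookup (rot k w) (cpred j)                          ≡⟨ lookup-rot k w (cpred j) ⟩
    lookup w ((toℕ (cpred j) ℕ.+ k ℕ.* m) mod suc m)    ≡⟨ cong (lookup w) (Fin.toℕ-injective index) ⟩
    lookup w ((toℕ j ℕ.+ suc k ℕ.* m) mod suc m)        ∎
    where
    index : toℕ ((toℕ (cpred j) ℕ.+ k ℕ.* m) mod suc m) ≡ toℕ ((toℕ j ℕ.+ suc k ℕ.* m) mod suc m)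
    index = begin
      toℕ ((toℕ (cpred j) ℕ.+ k ℕ.* m) mod suc m)   ≡⟨ Fin.toℕ-fromℕ< _ ⟩
      (toℕ (cpred j) ℕ.+ k ℕ.* m) % suc m           ≡⟨ cong (λ x → (x ℕ.+ k ℕ.* m) % suc m) (toℕ-cpred j) ⟩
      ((toℕ j ℕ.+ m) % suc m ℕ.+ k ℕ.* m) % suc m   ≡⟨ %-idemˡ-+ (toℕ j ℕ.+ m) (k ℕ.* m) (suc m) ⟩
      (toℕ j ℕ.+ m ℕ.+ k ℕ.* m) % suc m             ≡⟨ cong (_% suc m) (ℕ.+-assoc (toℕ j) m (k ℕ.* m)) ⟩
      (toℕ j ℕ.+ suc k ℕ.* m) % suc m               ≡⟨ Fin.toℕ-fromℕ< _ ⟨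
      toℕ ((toℕ j ℕ.+ suc k ℕ.* m) mod suc m)       ∎

  rot-period : ∀ {m} (w : Vec A (suc m)) → rot (suc m) w ≡ w
  rot-period {m} w = lookup-ext λ j → trans (lookup-rot (suc m) w j) (cong (lookup w) (Fin.toℕ-injective (begin
    toℕ ((toℕ j ℕ.+ suc m ℕ.* m) mod suc m)   ≡⟨ Fin.toℕ-fromℕ< _ ⟩
    (toℕ j ℕ.+ suc m ℕ.* m) % suc m           ≡⟨ cong (λ x → (toℕ j ℕ.+ x) % suc m) (ℕ.*-comm (suc m) m) ⟩
    (toℕ j ℕ.+ m ℕ.* suc m) % suc m           ≡⟨ [m+kn]%n≡m%n (toℕ j) m (suc m) ⟩
    toℕ j % suc m                             ≡⟨ m<n⇒m%n≡m (Fin.toℕ<n j) ⟩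
    toℕ j                                     ∎)))

  rot-multiple : ∀ {m} q (w : Vec A (suc m)) → rot (q ℕ.* suc m) w ≡ w
  rot-multiple zero        w = refl
  rot-multiple {m} (suc q) w = trans (rot-+ (suc m) (q ℕ.* suc m) w) (trans (cong (rot (suc m)) (rot-multiple q w)) (rot-period w))

  rot-mod : ∀ {m} k (w : Vec A (suc m)) → rot k w ≡ rot (k % suc m) w
  rot-mod {m} k w = begin
    rot k w                                           ≡⟨ cong (λ x → rot x w) (m≡m%n+[m/n]*n k (suc m)) ⟩
    rot (k % suc m ℕ.+ (k / suc m) ℕ.* suc m) w       ≡⟨ rot-+ (k % suc m) _ w ⟩
    rot (k % suc m) (rot ((k / suc m) ℕ.* suc m) w)   ≡⟨ cong (rot (k % suc m)) (rot-multiple (k / suc m) w) ⟩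
    rot (k % suc m) w                                 ∎

  lookup-iterate-shift : ∀ {n} k (v : Vec A n) (i : Fin k) → lookup (Vec.iterate shift v k) i ≡ rot (toℕ i) v
  lookup-iterate-shift (suc k) v Fin.zero    = refl
  lookup-iterate-shift (suc k) v (Fin.suc i) = trans (lookup-iterate-shift k (shift v) i) (rot-shift (toℕ i) v)

module LexSort {p n : ℕ} where

  ∈-insertLex⁻ : ∀ {k} {u y : Word p n} (vs : Vec (Word p n) k) → y ∈ insertLex u vs → y ≡ u ⊎ y ∈ vs
  ∈-insertLex⁻ [] (here y≡u) = inj₁ y≡u
  ∈-insertLex⁻ {u = u} (v ∷ vs) y∈ with lex≤ u v
  ∈-insertLex⁻ (v ∷ vs) (here y≡u)  | true  = inj₁ y≡u
  ∈-insertLex⁻ (v ∷ vs) (there y∈)  | true  = inj₂ y∈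
  ∈-insertLex⁻ (v ∷ vs) (here y≡v)  | false = inj₂ (here y≡v)
  ∈-insertLex⁻ (v ∷ vs) (there y∈)  | false with ∈-insertLex⁻ vs y∈
  ... | inj₁ y≡u  = inj₁ y≡u
  ... | inj₂ y∈vs = inj₂ (there y∈vs)

  ∈-insertLex⁺ˡ : ∀ {k} (u : Word p n) (vs : Vec (Word p n) k) → u ∈ insertLex u vs
  ∈-insertLex⁺ˡ u [] = here refl
  ∈-insertLex⁺ˡ u (v ∷ vs) with lex≤ u v
  ... | true  = here refl
  ... | false = there (∈-insertLex⁺ˡ u vs)

  ∈-insertLex⁺ʳ : ∀ {k} (u : Word p n) {y} (vs : Vec (Word p n) k) → y ∈ vs → y ∈ insertLex u vs
  ∈-insertLex⁺ʳ u (v ∷ vs) y∈ with lex≤ u v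
  ∈-insertLex⁺ʳ u (v ∷ vs) y∈          | true  = there y∈
  ∈-insertLex⁺ʳ u (v ∷ vs) (here y≡v)  | false = here y≡v
  ∈-insertLex⁺ʳ u (v ∷ vs) (there y∈)  | false = there (∈-insertLex⁺ʳ u vs y∈)

  ∈-sortLex⁻ : ∀ {k} {y : Word p n} (vs : Vec (Word p n) k) → y ∈ sortLex vs → y ∈ vs
  ∈-sortLex⁻ (v ∷ vs) y∈ with ∈-insertLex⁻ (sortLex vs) y∈
  ... | inj₁ y≡v = here y≡v
  ... | inj₂ y∈  = there (∈-sortLex⁻ vs y∈)

  ∈-sortLex⁺ : ∀ {k} {y : Word p n} (vs : Vec (Word p n) k) → y ∈ vs → y ∈ sortLex vs
  ∈-sortLex⁺ (v ∷ vs) (here refl) = ∈-insertLex⁺ˡ v (sortLex vs)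
  ∈-sortLex⁺ (v ∷ vs) (there y∈)  = ∈-insertLex⁺ʳ v (sortLex vs) (∈-sortLex⁺ vs y∈)

deduplicate-unique : ∀ {A : Set} (_≟_ : (x y : A) → Dec (x ≡ y)) {xs} → Unique xs → List.deduplicate _≟_ xs ≡ xs
deduplicate-unique _≟_ AllPairs.[]       = refl
deduplicate-unique _≟_ {x List.∷ xs} (x∉xs AllPairs.∷ unique) =
  cong (x List.∷_) (trans (cong (List.filter (¬? ∘ (x ≟_))) (deduplicate-unique _≟_ unique)) (List.filter-all (¬? ∘ (x ≟_)) x∉xs))

toList-unique : ∀ {A : Set} {k} (xs : Vec A k) → (∀ i i′ → lookup xs i ≡ lookup xs i′ → i ≡ i′) → Unique (Vec.toList xs)
toList-unique []       _         = AllPairs.[]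
toList-unique (x ∷ xs) injective =
  All.tabulate x∉xs AllPairs.∷ toList-unique xs (λ i i′ e → Fin.suc-injective (injective (Fin.suc i) (Fin.suc i′) e))
  where
  x∉xs : ∀ {y} → y List.∈ Vec.toList xs → x ≢ y
  x∉xs y∈ x≡y with injective Fin.zero (Fin.suc (Any.index (VecMembership.∈-toList⁻ y∈)))
                             (trans x≡y (Any.lookup-index (VecMembership.∈-toList⁻ y∈)))
  ... | ()

module Necklace (p : ℕ) .{{_ : NonZero p}} (p-prime : Prime p) where

  open PrimeField p
  open Determinant p
  open LinearAlgebra p p-prime
  open CyclicIndex
  open Rotations
  open LexSort
  open CommutativeRing +ₚ-*ₚ-commutativeRing using (_+_; _*_; 0#; 1#; +-identityʳ; *-identityʳ; zeroˡ; zeroʳ; distribʳ; *-assoc; semiring)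
  open SemiringSum semiring using (sum; sum-cong-≗; ∑-distrib-+; *-distribˡ-sum)
  open ≡-Reasoning

  ⟦CM⟧ : ∀ {n} (v : Word p n) i j → ⟦ CM v ⟧ i j ≡ lookup (rot (toℕ i) v) j
  ⟦CM⟧ {n} v i j = cong (λ row → lookup row j) (lookup-iterate-shift n v i)

  rowsIn : ∀ {n} (A B : Mat p n) → (∀ i → lookup A i ∈ B) → RowsIn ⟦ A ⟧ ⟦ B ⟧
  rowsIn A B A⊆B i = Any.index (A⊆B i) , λ j → cong (λ row → lookup row j) (Any.lookup-index (A⊆B i))

  BWM-nonsingular⇔ : ∀ {n} (w : Word p n) → Nonsingular (BWM w) ⇔ Nonsingularᶠ ⟦ CM w ⟧
  BWM-nonsingular⇔ w = mk⇔
    (λ BWM≢0 → nonsingular-rowsIn BWM⊆CM (BWM≢0 ∘ trans (det≡det′ (BWM w))))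
    (λ CM≢0 → nonsingular-rowsIn CM⊆BWM CM≢0 ∘ trans (sym (det≡det′ (BWM w))))
    where
    BWM⊆CM : RowsIn ⟦ BWM w ⟧ ⟦ CM w ⟧
    BWM⊆CM = rowsIn (BWM w) (CM w) (λ i → ∈-sortLex⁻ (CM w) (VecMembership.∈-lookup i (BWM w)))
    CM⊆BWM : RowsIn ⟦ CM w ⟧ ⟦ BWM w ⟧
    CM⊆BWM = rowsIn (CM w) (BWM w) (λ i → ∈-sortLex⁺ (CM w) (VecMembership.∈-lookup i (CM w)))

  rot-rowsIn : ∀ {m} k (w : Word p (suc m)) → RowsIn ⟦ CM (rot k w) ⟧ ⟦ CM w ⟧
  rot-rowsIn {m} k w i = (toℕ i ℕ.+ k) mod suc m , λ j → begin
    ⟦ CM (rot k w) ⟧ i j                        ≡⟨ ⟦CM⟧ (rot k w) i j ⟩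
    lookup (rot (toℕ i) (rot k w)) j            ≡⟨ cong (λ v → lookup v j) (rot-+ (toℕ i) k w) ⟨
    lookup (rot (toℕ i ℕ.+ k) w) j              ≡⟨ cong (λ v → lookup v j) (rot-mod (toℕ i ℕ.+ k) w) ⟩
    lookup (rot ((toℕ i ℕ.+ k) % suc m) w) j    ≡⟨ cong (λ x → lookup (rot x w) j) (toℕ-mod (toℕ i ℕ.+ k) (suc m)) ⟨
    lookup (rot (toℕ ((toℕ i ℕ.+ k) mod suc m)) w) j ≡⟨ ⟦CM⟧ w ((toℕ i ℕ.+ k) mod suc m) j ⟨
    ⟦ CM w ⟧ ((toℕ i ℕ.+ k) mod suc m) j        ∎

  ∈[]-refl : ∀ {m} (w : Word p (suc m)) → w ∈[ w ]
  ∈[]-refl w = Fin.zero , refl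

  ∈[]-sym : ∀ {m} {v w : Word p (suc m)} → v ∈[ w ] → w ∈[ v ]
  ∈[]-sym {m} {w = w} (i , refl) = (suc m ℕ.∸ toℕ i) mod suc m , (begin
    w                                                  ≡⟨ rot-period w ⟨
    rot (suc m) w                                      ≡⟨ cong (λ x → rot x w) (ℕ.m∸n+n≡m (ℕ.<⇒≤ (Fin.toℕ<n i))) ⟨
    rot (suc m ℕ.∸ toℕ i ℕ.+ toℕ i) w                  ≡⟨ rot-+ (suc m ℕ.∸ toℕ i) (toℕ i) w ⟩
    rot (suc m ℕ.∸ toℕ i) (rot (toℕ i) w)              ≡⟨ rot-mod (suc m ℕ.∸ toℕ i) _ ⟩
    rot ((suc m ℕ.∸ toℕ i) % suc m) (rot (toℕ i) w)    ≡⟨ cong (λ x → rot x (rot (toℕ i) w)) (toℕ-mod (suc m ℕ.∸ toℕ i) (suc m)) ⟨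
    rot (toℕ ((suc m ℕ.∸ toℕ i) mod suc m)) (rot (toℕ i) w) ∎)

  nonsingular-∈[] : ∀ {m} {v w : Word p (suc m)} → v ∈[ w ] → Nonsingularᶠ ⟦ CM v ⟧ → Nonsingularᶠ ⟦ CM w ⟧
  nonsingular-∈[] {w = w} (i , refl) = nonsingular-rowsIn (rot-rowsIn (toℕ i) w)

  invertible-rotations⇔ : ∀ {m} (w : Word p (suc m)) →
    (∀ v → v ∈[ w ] → Invertible (CM v)) ⇔ Nonsingularᶠ ⟦ CM w ⟧
  invertible-rotations⇔ w = mk⇔
    (λ invertible → Invertible⇒nonsingular {A = CM w} (invertible w (∈[]-refl w)))
    (λ CMw≢0 v v∈[w] → nonsingular⇒Invertible {A = CM v} (nonsingular-∈[] (∈[]-sym v∈[w]) CMw≢0))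

  CM·Q : ∀ {m} (v : Word p (suc m)) → CM v · Q ≡ CM (shift v)
  CM·Q v = ⟦⟧-injective λ i j → begin
    ⟦ CM v · Q ⟧ i j                          ≡⟨ ⟦·⟧ (CM v) Q i j ⟩
    sum (λ k → ⟦ CM v ⟧ i k * ⟦ Q ⟧ k j)      ≡⟨ sum-cong-≗ (λ k → cong (⟦ CM v ⟧ i k *_) (⟦toMat⟧ (λ k j → 𝐈 j (csuc {p} k)) k j)) ⟩
    sum (λ k → ⟦ CM v ⟧ i k * 𝐈 j (csuc {p} k))   ≡⟨ sum-single (λ k → ⟦ CM v ⟧ i k * 𝐈 j (csuc {p} k)) (cpred j) (λ k k≢ → trans (cong (⟦ CM v ⟧ i k *_) (𝐈-off (j≢csuc {j} k k≢))) (zeroʳ (⟦ CM v ⟧ i k))) ⟩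
    ⟦ CM v ⟧ i (cpred j) * 𝐈 j (csuc {p} (cpred j)) ≡⟨ cong (λ x → ⟦ CM v ⟧ i (cpred j) * 𝐈 j x) (csuc-cpred {p = p} j) ⟩
    ⟦ CM v ⟧ i (cpred j) * 𝐈 j j              ≡⟨ cong (⟦ CM v ⟧ i (cpred j) *_) (𝐈-diag j) ⟩
    ⟦ CM v ⟧ i (cpred j) * 1#                 ≡⟨ *-identityʳ (⟦ CM v ⟧ i (cpred j)) ⟩
    ⟦ CM v ⟧ i (cpred j)                      ≡⟨ ⟦CM⟧ v i (cpred j) ⟩
    lookup (rot (toℕ i) v) (cpred j)          ≡⟨ lookup-shift (rot (toℕ i) v) j ⟨
    lookup (shift (rot (toℕ i) v)) j          ≡⟨ cong (λ u → lookup u j) (rot-shift (toℕ i) v) ⟨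
    lookup (rot (toℕ i) (shift v)) j          ≡⟨ ⟦CM⟧ (shift v) i j ⟨
    ⟦ CM (shift v) ⟧ i j                      ∎
    where
    j≢csuc : ∀ {j} k → k ≢ cpred j → j ≢ csuc {p} k
    j≢csuc k k≢ j≡ = k≢ (trans (sym (cpred-csuc {p = p} k)) (cong cpred (sym j≡)))

  CM·Qᵏ : ∀ {m} (v : Word p (suc m)) k → CM v · (Q ^ᴹ k) ≡ CM (rot k v)
  CM·Qᵏ v zero    = ·-identityʳ (CM v)
  CM·Qᵏ v (suc k) = begin
    CM v · (Q · (Q ^ᴹ k))    ≡⟨ ·-assoc (CM v) Q (Q ^ᴹ k) ⟩
    (CM v · Q) · (Q ^ᴹ k)    ≡⟨ cong (_· (Q ^ᴹ k)) (CM·Q v) ⟩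
    CM (shift v) · (Q ^ᴹ k)  ≡⟨ CM·Qᵏ (shift v) k ⟩
    CM (rot k (shift v))     ≡⟨ cong CM (rot-shift k v) ⟩
    CM (rot (suc k) v)       ∎

  reutenauer⇔ : ∀ {m} (w : Word p (suc m)) → IsElemRG (CMset w) ⇔ Nonsingularᶠ ⟦ CM w ⟧
  reutenauer⇔ {m} w = mk⇔ to from
    where
    to : IsElemRG (CMset w) → Nonsingularᶠ ⟦ CM w ⟧
    to (A , (_ , invertible) , coset) with proj₂ (coset (A · (Q ^ᴹ 0))) (0 , refl)
    ... | v , v∈[w] , A·I≡CMv = nonsingular-∈[] v∈[w]
      (Invertible⇒nonsingular {A = CM v} (subst Invertible (trans (sym (·-identityʳ A)) A·I≡CMv) invertible))
    from : Nonsingularᶠ ⟦ CM w ⟧ → IsElemRG (CMset w)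
    from CMw≢0 = CM w , ((w , refl) , nonsingular⇒Invertible {A = CM w} CMw≢0) , λ M → toCoset M , fromCoset M
      where
      toCoset : ∀ M → CMset w M → ∃ λ k → M ≡ CM w · (Q ^ᴹ k)
      toCoset M (v , (i , refl) , M≡CMv) = toℕ i , trans M≡CMv (sym (CM·Qᵏ w (toℕ i)))
      fromCoset : ∀ M → (∃ λ k → M ≡ CM w · (Q ^ᴹ k)) → CMset w M
      fromCoset M (k , M≡) = rot (toℕ (k mod suc m)) w , (k mod suc m , refl) ,
        trans M≡ (trans (CM·Qᵏ w k) (cong CM (trans (rot-mod k w) (cong (λ x → rot x w) (sym (toℕ-mod k (suc m)))))))

  combination : ∀ {n} → (Word p n → Fin p) → List (Word p n) → Word p n
  combination c = List.foldr (λ v acc → Vec.zipWith _+ₚ_ (Vec.map (c v *ₚ_) v) acc) (Vec.replicate _ 𝟘)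

  lookup-combination : ∀ {n k} (c : Word p n → Fin p) (R : Vec (Word p n) k) j →
    lookup (combination c (Vec.toList R)) j ≡ sum (λ i → c (lookup R i) * lookup (lookup R i) j)
  lookup-combination c []      j = Vec.lookup-replicate j 𝟘
  lookup-combination c (r ∷ R) j = begin
    lookup (Vec.zipWith _+ₚ_ (Vec.map (c r *ₚ_) r) (combination c (Vec.toList R))) j
      ≡⟨ Vec.lookup-zipWith _+ₚ_ j (Vec.map (c r *ₚ_) r) _ ⟩
    lookup (Vec.map (c r *ₚ_) r) j + lookup (combination c (Vec.toList R)) j
      ≡⟨ cong₂ _+_ (Vec.lookup-map j (c r *ₚ_) r) (lookup-combination c R j) ⟩
    c r * lookup r j + sum (λ i → c (lookup R i) * lookup (lookup R i) j)  ∎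

  combination-orthogonal : ∀ {n} (c : Word p n → Fin p) L (z : Vector (Fin p) n) →
    (∀ v → v List.∈ L → lookup v ∙ z ≡ 0#) → lookup (combination c L) ∙ z ≡ 0#
  combination-orthogonal c List.[] z _ = ∙-zeroˡ z (λ l → Vec.lookup-replicate l 𝟘)
  combination-orthogonal c (v List.∷ L) z L⊥z = begin
    sum (λ l → lookup (Vec.zipWith _+ₚ_ (Vec.map (c v *ₚ_) v) rest) l * z l)
      ≡⟨ sum-cong-≗ (λ l → cong (_* z l) (trans (Vec.lookup-zipWith _+ₚ_ l (Vec.map (c v *ₚ_) v) rest)
                                                 (cong (_+ lookup rest l) (Vec.lookup-map l (c v *ₚ_) v)))) ⟩
    sum (λ l → (c v * lookup v l + lookup rest l) * z l)
      ≡⟨ sum-cong-≗ (λ l → trans (distribʳ (z l) (c v * lookup v l) (lookup rest l)) (cong (_+ lookup rest l * z l) (*-assoc (c v) (lookup v l) (z l)))) ⟩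
    sum (λ l → c v * (lookup v l * z l) + lookup rest l * z l)
      ≡⟨ ∑-distrib-+ (λ l → c v * (lookup v l * z l)) (λ l → lookup rest l * z l) ⟩
    sum (λ l → c v * (lookup v l * z l)) + lookup rest ∙ z
      ≡⟨ cong₂ _+_ (sym (*-distribˡ-sum (c v) (λ l → lookup v l * z l))) (combination-orthogonal c L z (λ u u∈L → L⊥z u (ListAny.there u∈L))) ⟩
    c v * (lookup v ∙ z) + 0#
      ≡⟨ cong (λ x → c v * x + 0#) (L⊥z v (ListAny.here refl)) ⟩
    c v * 0# + 0#
      ≡⟨ trans (+-identityʳ (c v * 0#)) (zeroʳ (c v)) ⟩
    0#  ∎
    where
    rest = combination c L

  _≟ʷ_ : ∀ {n} (u v : Word p n) → Dec (u ≡ v)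
  _≟ʷ_ = Vec.≡-dec Fin._≟_

  ∈-necklace⁻ : ∀ {n} {v w : Word p n} → v List.∈ necklace w → ∃ λ i → v ≡ lookup (CM w) i
  ∈-necklace⁻ {v = v} {w} v∈ = Any.index v∈CM , Any.lookup-index v∈CM
    where
    v∈CM : v ∈ CM w
    v∈CM = VecMembership.∈-toList⁻ (List.∈-deduplicate⁻ _≟ʷ_ (Vec.toList (CM w)) v∈)

  necklace-distinct : ∀ {n} (w : Word p n) → Nonsingularᶠ ⟦ CM w ⟧ → necklace w ≡ Vec.toList (CM w)
  necklace-distinct w CMw≢0 = deduplicate-unique _≟ʷ_ (toList-unique (CM w) λ i i′ e →
    nonsingular⇒rows-injective CMw≢0 i i′ (λ j → cong (λ row → lookup row j) e))

  NecklaceBasis : ∀ {n} → Word p n → Set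
  NecklaceBasis {n} w = ∀ (x : Word p n) → (∃ λ (c : Word p n → Fin p) → combo c w ≡ x)
                      × (∀ (c d : Word p n → Fin p) → combo c w ≡ x → combo d w ≡ x → ∀ v → v ∈[ w ] → c v ≡ d v)

  -- every combination of the rotations is orthogonal to the kernel of CM_w
  spanning⇒nonsingular : ∀ {n} (w : Word p n) → (∀ x → ∃ λ c → combo c w ≡ x) → Nonsingularᶠ ⟦ CM w ⟧
  spanning⇒nonsingular w spans = kernel-orthogonal⇒nonsingular orthogonal
    where
    orthogonal : ∀ y z → (∀ i → (⟦ CM w ⟧ *ᵥ z) i ≡ 0#) → y ∙ z ≡ 0#
    orthogonal y z CMz≡0 with spans (tabulate y)
    ... | c , combo≡y = begin
      y ∙ z                    ≡⟨ sum-cong-≗ (λ l → cong (_* z l) (trans (sym (Vec.lookup∘tabulate y l)) (cong (λ x → lookup x l) (sym combo≡y)))) ⟩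
      lookup (combo c w) ∙ z   ≡⟨ combination-orthogonal c (necklace w) z rows⊥z ⟩
      0#                       ∎
      where
      rows⊥z : ∀ v → v List.∈ necklace w → lookup v ∙ z ≡ 0#
      rows⊥z v v∈ with ∈-necklace⁻ {w = w} v∈
      ... | i , refl = CMz≡0 i

  module _ {n} (w : Word p n) (CMw≢0 : Nonsingularᶠ ⟦ CM w ⟧) where

    private
      M : Matrix n
      M = ⟦ CM w ⟧
      row : Fin n → Word p n
      row = lookup (CM w)

    lookup-combo : ∀ c j → lookup (combo c w) j ≡ ((c ∘ row) ᵥ* M) j
    lookup-combo c j = trans (cong (λ L → lookup (combination c L) j) (necklace-distinct w CMw≢0)) (lookup-combination c (CM w) j)

    coefficients : ∀ (a : Vector (Fin p) n) → ∃ λ (c : Word p n → Fin p) → ∀ i → c (row i) ≡ a i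
    coefficients a = c , λ i → trans (sum-single _ i (off i)) (on i)
      where
      c : Word p n → Fin p
      c v = sum (λ i → if does (v ≟ʷ row i) then a i else 0#)
      off : ∀ i i′ → i′ ≢ i → (if does (row i ≟ʷ row i′) then a i′ else 0#) ≡ 0#
      off i i′ i′≢i with row i ≟ʷ row i′
      ... | yes rowᵢ≡rowᵢ′ = ⊥-elim (i′≢i (sym (nonsingular⇒rows-injective CMw≢0 i i′ (λ j → cong (λ r → lookup r j) rowᵢ≡rowᵢ′))))
      ... | no _           = refl
      on : ∀ i → (if does (row i ≟ʷ row i) then a i else 0#) ≡ a i
      on i with row i ≟ʷ row i
      ... | yes _        = refl
      ... | no rowᵢ≢rowᵢ = ⊥-elim (rowᵢ≢rowᵢ refl)

    nonsingular⇒spanning : ∀ x → ∃ λ c → combo c w ≡ x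
    nonsingular⇒spanning x = c , lookup-ext λ j → begin
      lookup (combo c w) j  ≡⟨ lookup-combo c j ⟩
      ((c ∘ row) ᵥ* M) j    ≡⟨ sum-cong-≗ (λ i → cong (_* M i j) (c-row i)) ⟩
      (a ᵥ* M) j            ≡⟨ proj₂ (nonsingular⇒ᵥ*-surjective CMw≢0 (lookup x)) j ⟩
      lookup x j            ∎
      where
      a : Vector (Fin p) n
      a = proj₁ (nonsingular⇒ᵥ*-surjective CMw≢0 (lookup x))
      c : Word p n → Fin p
      c = proj₁ (coefficients a)
      c-row : ∀ i → c (row i) ≡ a i
      c-row = proj₂ (coefficients a)

    nonsingular⇒combo-injective : ∀ c d → combo c w ≡ combo d w → ∀ v → v ∈[ w ] → c v ≡ d v
    nonsingular⇒combo-injective c d c≡d v (i , refl) = subst (λ u → c u ≡ d u) (lookup-iterate-shift n w i)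
      (nonsingular⇒ᵥ*-injective CMw≢0 (c ∘ row) (d ∘ row) cM≡dM i)
      where
      cM≡dM : ∀ j → ((c ∘ row) ᵥ* M) j ≡ ((d ∘ row) ᵥ* M) j
      cM≡dM j = trans (sym (lookup-combo c j)) (trans (cong (λ y → lookup y j) c≡d) (lookup-combo d j))

  unique-combination⇔ : ∀ {n} (w : Word p n) → NecklaceBasis w ⇔ Nonsingularᶠ ⟦ CM w ⟧
  unique-combination⇔ w = mk⇔ (λ basis → spanning⇒nonsingular w (proj₁ ∘ basis)) λ CMw≢0 x →
    nonsingular⇒spanning w CMw≢0 x , λ c d c≡x d≡x → nonsingular⇒combo-injective w CMw≢0 c d (trans c≡x (sym d≡x))

module FiniteField (p : ℕ) .{{_ : NonZero p}} (p-prime : Prime p)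
                   (F : CommutativeRing 0ℓ 0ℓ) (m : ℕ) (F-isGF : IsGF p (suc m) F) where

  open CommutativeRing F renaming (refl to ≈-refl; sym to ≈-sym; trans to ≈-trans; reflexive to ≈-reflexive)
  open IsGF F-isGF
  open FieldOps {p} F
  open SetoidReasoning setoid
  open SemiringMult semiring using (×-homo-+; ×-assocˡ; ×-assoc-*; ×1-homo-*; ×-congʳ; ×-homo-1) renaming (_×_ to _⊠_)
  open SemiringExp semiring using (_^_; ^-congˡ; ^-assocʳ)
  open CommutativeMonoidMult +-commutativeMonoid using (×-distrib-+)
  open Binomial commutativeSemiring using (binomialTerm) renaming (theorem to binomial-theorem)
  module ∑ = CommutativeMonoidSum +-commutativeMonoid
  module ∏ = CommutativeMonoidSum *-commutativeMonoid
  open CyclicIndex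
  open Rotations using (lookup-shift)
  open Determinant p using (⟦_⟧; sumₚ≡sum)
  open LinearAlgebra p p-prime using (_ᵥ*_; Nonsingularᶠ; nonsingular⇒ᵥ*-surjective; nonsingular⇒ᵥ*-injective; ᵥ*-surjective⇒nonsingular)
  open Necklace p p-prime using (⟦CM⟧; nonsingular-∈[]; ∈[]-sym; ∈[]-refl)
  open SemiringSum (CommutativeRing.semiring (PrimeField.+ₚ-*ₚ-commutativeRing p)) using (sum-cong-≗)

  n q : ℕ
  n = suc m
  q = p ℕ.^ n

  ⊠-zeroʳ : ∀ k → k ⊠ 0# ≈ 0#
  ⊠-zeroʳ zero    = ≈-refl
  ⊠-zeroʳ (suc k) = ≈-trans (+-identityˡ (k ⊠ 0#)) (⊠-zeroʳ k)

  pow≡^ : ∀ x k → pow x k ≡ x ^ k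
  pow≡^ x zero    = refl
  pow≡^ x (suc k) = cong (x *_) (pow≡^ x k)

  ⊠-unique : ∀ x (g : ℕ → Carrier) → g 0 ≡ 0# → (∀ k → g (suc k) ≡ x + g k) → ∀ k → g k ≡ k ⊠ x
  ⊠-unique x g g0 gsuc zero    = g0
  ⊠-unique x g g0 gsuc (suc k) = trans (gsuc k) (cong (x +_) (⊠-unique x g g0 gsuc k))

  -- scal and frobComb are defined through where-bound helpers, which cannot be named; with-abstracting
  -- all arguments of such a helper lets unification identify it with the g of a uniqueness lemma.
  scal≡⊠ : ∀ c x → scal c x ≡ toℕ c ⊠ x
  scal≡⊠ c x with toℕ c | ⊠-unique x _ refl (λ _ → refl)
  ... | k | unique = unique k

  frobSum : Carrier → ∀ {k} → Vec (Fin p) k → ℕ → Carrier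
  frobSum γ []       j = 0#
  frobSum γ (c ∷ cs) j = scal c (pow γ (p ℕ.^ j)) + frobSum γ cs (suc j)

  frobComb-helper≡ : ∀ γ (g : ∀ {l} → Vec (Fin p) l → ∀ {k} → Vec (Fin p) k → ℕ → Carrier) →
    (∀ {l} (C : Vec (Fin p) l) j → g C [] j ≡ 0#) →
    (∀ {l} (C : Vec (Fin p) l) {k} c (cs : Vec (Fin p) k) j → g C (c ∷ cs) j ≡ scal c (pow γ (p ℕ.^ j)) + g C cs (suc j)) →
    ∀ {l} (C : Vec (Fin p) l) {k} (cs : Vec (Fin p) k) j → g C cs j ≡ frobSum γ cs j
  frobComb-helper≡ γ g g[] g∷ C []       j = g[] C j
  frobComb-helper≡ γ g g[] g∷ C (c ∷ cs) j = trans (g∷ C c cs j) (cong (scal c (pow γ (p ℕ.^ j)) +_) (frobComb-helper≡ γ g g[] g∷ C cs (suc j)))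

  frobComb≡frobSum-∷ : ∀ γ (v : Σ ℕ λ k → Fin p × Vec (Fin p) k) →
    frobComb γ (proj₁ (proj₂ v) ∷ proj₂ (proj₂ v)) ≡ frobSum γ (proj₁ (proj₂ v) ∷ proj₂ (proj₂ v)) 0
  frobComb≡frobSum-∷ γ v with proj₁ v | suc (proj₁ v) | proj₂ (proj₂ v) | proj₁ (proj₂ v) ∷ proj₂ (proj₂ v) | 1
                            | frobComb-helper≡ γ _ (λ _ _ → refl) (λ _ _ _ _ → refl)
  ... | _ | _ | bs | C | j | helper≡ = cong (_ +_) (helper≡ C bs j)

  frobComb≡frobSum : ∀ γ {k} (c : Vec (Fin p) k) → frobComb γ c ≡ frobSum γ c 0
  frobComb≡frobSum γ []               = refl
  frobComb≡frobSum γ {suc k} (a ∷ cs) = frobComb≡frobSum-∷ γ (k , a , cs)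

  frobSum≈ : ∀ γ {k} (cs : Vec (Fin p) k) j → frobSum γ cs j ≈ ∑.sum (λ i → toℕ (lookup cs i) ⊠ γ ^ (p ℕ.^ (j ℕ.+ toℕ i)))
  frobSum≈ γ []       j = ≈-refl
  frobSum≈ γ (c ∷ cs) j = begin
    scal c (pow γ (p ℕ.^ j)) + frobSum γ cs (suc j)  ≈⟨ +-cong (≈-reflexive head) (frobSum≈ γ cs (suc j)) ⟩
    toℕ c ⊠ γ ^ (p ℕ.^ (j ℕ.+ 0)) + ∑.sum (λ i → toℕ (lookup cs i) ⊠ γ ^ (p ℕ.^ (suc j ℕ.+ toℕ i)))
      ≡⟨ cong (toℕ c ⊠ γ ^ (p ℕ.^ (j ℕ.+ 0)) +_) (∑.sum-cong-≗ (λ i → cong (λ e → toℕ (lookup cs i) ⊠ γ ^ (p ℕ.^ e)) (sym (ℕ.+-suc j (toℕ i))))) ⟩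
    ∑.sum (λ i → toℕ (lookup (c ∷ cs) i) ⊠ γ ^ (p ℕ.^ (j ℕ.+ toℕ i)))  ∎
    where
    head : scal c (pow γ (p ℕ.^ j)) ≡ toℕ c ⊠ γ ^ (p ℕ.^ (j ℕ.+ 0))
    head = trans (scal≡⊠ c (pow γ (p ℕ.^ j))) (cong (toℕ c ⊠_) (trans (pow≡^ γ (p ℕ.^ j)) (cong (λ e → γ ^ (p ℕ.^ e)) (sym (ℕ.+-identityʳ j)))))

  frobComb≈ : ∀ γ {k} (c : Vec (Fin p) k) → frobComb γ c ≈ ∑.sum (λ i → toℕ (lookup c i) ⊠ γ ^ (p ℕ.^ toℕ i))
  frobComb≈ γ c = ≈-trans (≈-reflexive (frobComb≡frobSum γ c)) (frobSum≈ γ c 0)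

  index : Carrier → Fin q
  index x = proj₁ (enum-surj x)

  enum-index : ∀ x → enum (index x) ≈ x
  enum-index x = proj₂ (enum-surj x)

  infix 4 _≈?_
  _≈?_ : ∀ x y → Dec (x ≈ y)
  x ≈? y with index x Fin.≟ index y
  ... | yes i≡j = yes (≈-trans (≈-sym (enum-index x)) (≈-trans (≈-reflexive (cong enum i≡j)) (enum-index y)))
  ... | no i≢j  = no (λ x≈y → i≢j (enum-inj _ _ (≈-trans (enum-index x) (≈-trans x≈y (≈-sym (enum-index y))))))

  *-cancelʳ : ∀ a b {c} → ¬ c ≈ 0# → a * c ≈ b * c → a ≈ b
  *-cancelʳ a b {c} c≉0 ac≈bc = begin
    a                ≈⟨ *-identityʳ a ⟨
    a * 1#           ≈⟨ *-congˡ c*c⁻¹≈1 ⟨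
    a * (c * c⁻¹)    ≈⟨ *-assoc a c c⁻¹ ⟨
    (a * c) * c⁻¹    ≈⟨ *-congʳ ac≈bc ⟩
    (b * c) * c⁻¹    ≈⟨ *-assoc b c c⁻¹ ⟩
    b * (c * c⁻¹)    ≈⟨ *-congˡ c*c⁻¹≈1 ⟩
    b * 1#           ≈⟨ *-identityʳ b ⟩
    b                ∎
    where
    c⁻¹ : Carrier
    c⁻¹ = proj₁ (inverse c c≉0)
    c*c⁻¹≈1 : c * c⁻¹ ≈ 1#
    c*c⁻¹≈1 = proj₂ (inverse c c≉0)

  *-≉0 : ∀ {x y} → ¬ x ≈ 0# → ¬ y ≈ 0# → ¬ x * y ≈ 0#
  *-≉0 {x} {y} x≉0 y≉0 xy≈0 = y≉0 (*-cancelʳ y 0# x≉0 (begin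
    y * x    ≈⟨ *-comm y x ⟩
    x * y    ≈⟨ xy≈0 ⟩
    0#       ≈⟨ zeroˡ x ⟨
    0# * x   ∎))

  ^-≉0 : ∀ {x} k → ¬ x ≈ 0# → ¬ x ^ k ≈ 0#
  ^-≉0 zero    x≉0 = nontrivial
  ^-≉0 (suc k) x≉0 = *-≉0 x≉0 (^-≉0 k x≉0)

  ^≈0⇒≈0 : ∀ {x} k → x ^ suc k ≈ 0# → x ≈ 0#
  ^≈0⇒≈0 {x} k xᵏ⁺¹≈0 with x ≈? 0#
  ... | yes x≈0 = x≈0
  ... | no x≉0  = ⊥-elim (^-≉0 (suc k) x≉0 xᵏ⁺¹≈0)

  ∏-≉0 : ∀ {k} (t : Fin k → Carrier) → (∀ i → ¬ t i ≈ 0#) → ¬ ∏.sum t ≈ 0#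
  ∏-≉0 {zero}  t t≉0 = nontrivial
  ∏-≉0 {suc k} t t≉0 = *-≉0 (t≉0 Fin.zero) (∏-≉0 (t ∘ Fin.suc) (t≉0 ∘ Fin.suc))

  ∏-single : ∀ {k} (t : Fin k → Carrier) (i : Fin k) → (∀ j → j ≢ i → t j ≈ 1#) → ∏.sum t ≈ t i
  ∏-single {suc k} t Fin.zero t≈1 = begin
    t Fin.zero * ∏.sum (t ∘ Fin.suc)  ≈⟨ *-congˡ (∏.sum-cong-≋ {k} {t ∘ Fin.suc} {λ _ → 1#} (λ j → t≈1 (Fin.suc j) (λ ()))) ⟩
    t Fin.zero * ∏.sum {k} (λ _ → 1#) ≈⟨ *-congˡ (∏.sum-replicate-zero k) ⟩
    t Fin.zero * 1#                   ≈⟨ *-identityʳ (t Fin.zero) ⟩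
    t Fin.zero                        ∎
  ∏-single {suc k} t (Fin.suc i) t≈1 = begin
    t Fin.zero * ∏.sum (t ∘ Fin.suc)  ≈⟨ *-congʳ (t≈1 Fin.zero (λ ())) ⟩
    1# * ∏.sum (t ∘ Fin.suc)          ≈⟨ *-identityˡ _ ⟩
    ∏.sum (t ∘ Fin.suc)               ≈⟨ ∏-single (t ∘ Fin.suc) i (λ j j≢i → t≈1 (Fin.suc j) (j≢i ∘ Fin.suc-injective)) ⟩
    t (Fin.suc i)                     ∎

  -- a bijection of F permutes the enumeration, so sums and products over F are invariant under it
  module Reindex (h h⁻¹ : Carrier → Carrier) (h-cong : ∀ {x y} → x ≈ y → h x ≈ h y) (h⁻¹-cong : ∀ {x y} → x ≈ y → h⁻¹ x ≈ h⁻¹ y)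
                 (h∘h⁻¹ : ∀ x → h (h⁻¹ x) ≈ x) (h⁻¹∘h : ∀ x → h⁻¹ (h x) ≈ x) where

    π : Permutation q q
    π = permutation (λ i → index (h (enum i))) (λ i → index (h⁻¹ (enum i)))
      (λ i → enum-inj _ _ (≈-trans (enum-index _) (≈-trans (h-cong (enum-index _)) (h∘h⁻¹ (enum i)))))
      (λ i → enum-inj _ _ (≈-trans (enum-index _) (≈-trans (h⁻¹-cong (enum-index _)) (h⁻¹∘h (enum i)))))

    ∑-reindex : ∀ (t : Carrier → Carrier) → (∀ {x y} → x ≈ y → t x ≈ t y) → ∑.sum (t ∘ enum) ≈ ∑.sum (t ∘ h ∘ enum)
    ∑-reindex t t-cong = ≈-trans (∑.sum-permute (t ∘ enum) π) (∑.sum-cong-≋ {q} {t ∘ enum ∘ (π ⟨$⟩ʳ_)} {t ∘ h ∘ enum} (λ i → t-cong (enum-index (h (enum i)))))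

    ∏-reindex : ∀ (t : Carrier → Carrier) → (∀ {x y} → x ≈ y → t x ≈ t y) → ∏.sum (t ∘ enum) ≈ ∏.sum (t ∘ h ∘ enum)
    ∏-reindex t t-cong = ≈-trans (∏.sum-permute (t ∘ enum) π) (∏.sum-cong-≋ {q} {t ∘ enum ∘ (π ⟨$⟩ʳ_)} {t ∘ h ∘ enum} (λ i → t-cong (enum-index (h (enum i)))))

  -- Σₓ x = Σₓ (x + 1) = Σₓ x + q ⊠ 1
  q⊠1≈0 : q ⊠ 1# ≈ 0#
  q⊠1≈0 = begin
    q ⊠ 1#                   ≈⟨ +-identityˡ (q ⊠ 1#) ⟨
    0# + q ⊠ 1#              ≈⟨ +-congʳ (-‿inverseˡ ∑F) ⟨
    (- ∑F + ∑F) + q ⊠ 1#     ≈⟨ +-assoc (- ∑F) ∑F (q ⊠ 1#) ⟩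
    - ∑F + (∑F + q ⊠ 1#)     ≈⟨ +-congˡ ∑F+q⊠1≈∑F ⟩
    - ∑F + ∑F                ≈⟨ -‿inverseˡ ∑F ⟩
    0#                       ∎
    where
    open Reindex (_+ 1#) (_+ - 1#) +-congʳ +-congʳ
      (λ x → ≈-trans (+-assoc x (- 1#) 1#) (≈-trans (+-congˡ (-‿inverseˡ 1#)) (+-identityʳ x)))
      (λ x → ≈-trans (+-assoc x 1# (- 1#)) (≈-trans (+-congˡ (-‿inverseʳ 1#)) (+-identityʳ x)))
    ∑F = ∑.sum enum
    ∑F+q⊠1≈∑F : ∑F + q ⊠ 1# ≈ ∑F
    ∑F+q⊠1≈∑F = begin
      ∑F + q ⊠ 1#                        ≈⟨ +-congˡ (∑.sum-replicate q) ⟨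
      ∑F + ∑.sum {q} (λ _ → 1#)          ≈⟨ ∑.∑-distrib-+ enum (λ _ → 1#) ⟨
      ∑.sum (λ i → enum i + 1#)          ≈⟨ ∑-reindex (λ x → x) (λ x≈y → x≈y) ⟨
      ∑F                                 ∎

  [p^k]⊠1≈[p⊠1]^k : ∀ k → (p ℕ.^ k) ⊠ 1# ≈ (p ⊠ 1#) ^ k
  [p^k]⊠1≈[p⊠1]^k zero    = ×-homo-1 1#
  [p^k]⊠1≈[p⊠1]^k (suc k) = ≈-trans (×1-homo-* p (p ℕ.^ k)) (*-congˡ ([p^k]⊠1≈[p⊠1]^k k))

  p⊠1≈0 : p ⊠ 1# ≈ 0#
  p⊠1≈0 = ^≈0⇒≈0 m (≈-trans (≈-sym ([p^k]⊠1≈[p⊠1]^k n)) q⊠1≈0)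

  p⊠x≈0 : ∀ x → p ⊠ x ≈ 0#
  p⊠x≈0 x = begin
    p ⊠ x          ≈⟨ ×-congʳ p (*-identityˡ x) ⟨
    p ⊠ (1# * x)   ≈⟨ ×-assoc-* p 1# x ⟨
    (p ⊠ 1#) * x   ≈⟨ *-congʳ p⊠1≈0 ⟩
    0# * x         ≈⟨ zeroˡ x ⟩
    0#             ∎

  [d*p]⊠x≈0 : ∀ d x → (d ℕ.* p) ⊠ x ≈ 0#
  [d*p]⊠x≈0 d x = ≈-trans (≈-sym (×-assocˡ x d p)) (≈-trans (×-congʳ d (p⊠x≈0 x)) (⊠-zeroʳ d))

  ⊠-mod : ∀ k x → k ⊠ x ≈ (k % p) ⊠ x
  ⊠-mod k x = begin
    k ⊠ x                                  ≡⟨ cong (_⊠ x) (m≡m%n+[m/n]*n k p) ⟩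
    (k % p ℕ.+ (k / p) ℕ.* p) ⊠ x          ≈⟨ ×-homo-+ x (k % p) ((k / p) ℕ.* p) ⟩
    (k % p) ⊠ x + ((k / p) ℕ.* p) ⊠ x      ≈⟨ +-congˡ ([d*p]⊠x≈0 (k / p) x) ⟩
    (k % p) ⊠ x + 0#                       ≈⟨ +-identityʳ _ ⟩
    (k % p) ⊠ x                            ∎

  toℕ-+ₚ-⊠ : ∀ (a b : Fin p) x → toℕ (a +ₚ b) ⊠ x ≈ toℕ a ⊠ x + toℕ b ⊠ x
  toℕ-+ₚ-⊠ a b x = begin
    toℕ (a +ₚ b) ⊠ x              ≡⟨ cong (_⊠ x) (toℕ-mod (toℕ a ℕ.+ toℕ b) p) ⟩
    ((toℕ a ℕ.+ toℕ b) % p) ⊠ x   ≈⟨ ⊠-mod (toℕ a ℕ.+ toℕ b) x ⟨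
    (toℕ a ℕ.+ toℕ b) ⊠ x         ≈⟨ ×-homo-+ x (toℕ a) (toℕ b) ⟩
    toℕ a ⊠ x + toℕ b ⊠ x         ∎

  toℕ-*ₚ-⊠ : ∀ (a b : Fin p) x → toℕ (a *ₚ b) ⊠ x ≈ toℕ a ⊠ (toℕ b ⊠ x)
  toℕ-*ₚ-⊠ a b x = begin
    toℕ (a *ₚ b) ⊠ x              ≡⟨ cong (_⊠ x) (toℕ-mod (toℕ a ℕ.* toℕ b) p) ⟩
    ((toℕ a ℕ.* toℕ b) % p) ⊠ x   ≈⟨ ⊠-mod (toℕ a ℕ.* toℕ b) x ⟨
    (toℕ a ℕ.* toℕ b) ⊠ x         ≈⟨ ×-assocˡ x (toℕ a) (toℕ b) ⟨
    toℕ a ⊠ (toℕ b ⊠ x)           ∎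

  toℕ-sumₚ-⊠ : ∀ {k} (f : Fin k → Fin p) x → toℕ (sumₚ f) ⊠ x ≈ ∑.sum (λ j → toℕ (f j) ⊠ x)
  toℕ-sumₚ-⊠ {zero}  f x = ≈-trans (≈-reflexive (cong (_⊠ x) (toℕ-mod 0 p))) (≈-sym (⊠-mod 0 x))
  toℕ-sumₚ-⊠ {suc k} f x = ≈-trans (toℕ-+ₚ-⊠ (f Fin.zero) (sumₚ (f ∘ Fin.suc)) x) (+-congˡ (toℕ-sumₚ-⊠ (f ∘ Fin.suc) x))

  ⊠-distrib-∑ : ∀ k {l} (f : Fin l → Carrier) → k ⊠ ∑.sum f ≈ ∑.sum (λ i → k ⊠ f i)
  ⊠-distrib-∑ k {zero}  f = ⊠-zeroʳ k
  ⊠-distrib-∑ k {suc l} f = ≈-trans (×-distrib-+ _ _ k) (+-congˡ (⊠-distrib-∑ k (f ∘ Fin.suc)))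

  binomial-middle : ∀ P → 1 ℕ.< P → (∀ k z → 0 ℕ.< k → k ℕ.< P → (P choose k) ⊠ z ≈ 0#) →
    ∀ x y → (x + y) ^ P ≈ x ^ P + y ^ P
  binomial-middle (suc zero) (ℕ.s≤s ())
  binomial-middle (suc (suc r)) _ middle≈0 x y = begin
    (x + y) ^ P                                              ≈⟨ binomial-theorem P x y ⟩
    ∑.sum (binomialTerm x y P)                               ≈⟨ +-congˡ (∑.sum-init-last (binomialTerm x y P ∘ Fin.suc)) ⟩
    term Fin.zero + (∑.sum (λ i → term (Fin.suc (inject₁ i))) + term (Fin.fromℕ P))
                                                             ≈⟨ +-congˡ (+-congʳ (∑.sum-cong-≋ {suc r} {λ i → term (Fin.suc (inject₁ i))} {λ _ → 0#} middle)) ⟩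
    term Fin.zero + (∑.sum {suc r} (λ _ → 0#) + term (Fin.fromℕ P))
                                                             ≈⟨ +-congˡ (≈-trans (+-congʳ (∑.sum-replicate-zero (suc r))) (+-identityˡ _)) ⟩
    term Fin.zero + term (Fin.fromℕ P)                       ≈⟨ +-cong (≈-trans (+-identityʳ _) (*-identityˡ _)) last ⟩
    y ^ P + x ^ P                                            ≈⟨ +-comm (y ^ P) (x ^ P) ⟩
    x ^ P + y ^ P                                            ∎
    where
    P = suc (suc r)
    term = binomialTerm x y P
    middle : ∀ i → term (Fin.suc (inject₁ i)) ≈ 0#
    middle i = middle≈0 (suc (toℕ (inject₁ i))) _ (ℕ.s≤s ℕ.z≤n)
      (ℕ.s≤s (subst (ℕ._< suc r) (sym (Fin.toℕ-inject₁ i)) (Fin.toℕ<n i)))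
    last : term (Fin.fromℕ P) ≈ x ^ P
    last = begin
      (P choose toℕ (Fin.fromℕ P)) ⊠ (x ^ toℕ (Fin.fromℕ P) * y ^ (P ℕ.∸ toℕ (Fin.fromℕ P)))
        ≡⟨ cong (λ k → (P choose k) ⊠ (x ^ k * y ^ (P ℕ.∸ k))) (Fin.toℕ-fromℕ P) ⟩
      (P choose P) ⊠ (x ^ P * y ^ (P ℕ.∸ P))   ≡⟨ cong₂ (λ c e → c ⊠ (x ^ P * y ^ e)) (nCn≡1 P) (ℕ.n∸n≡0 P) ⟩
      1 ⊠ (x ^ P * 1#)                         ≈⟨ ×-homo-1 _ ⟩
      x ^ P * 1#                               ≈⟨ *-identityʳ (x ^ P) ⟩
      x ^ P                                    ∎

  frobenius-+ : ∀ x y → (x + y) ^ p ≈ x ^ p + y ^ p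
  frobenius-+ = binomial-middle p (ℕ.nonTrivial⇒n>1 p {{prime⇒nonTrivial p-prime}}) λ k z 0<k k<p →
    let (divides d pCk≡d*p) = prime∣pCk p-prime k 0<k k<p in ≈-trans (≈-reflexive (cong (_⊠ z) pCk≡d*p)) ([d*p]⊠x≈0 d z)

  0^p≈0 : 0# ^ p ≈ 0#
  0^p≈0 = ≈-trans (≈-reflexive (cong (0# ^_) (sym (ℕ.suc-pred p)))) (zeroˡ _)

  frobenius-⊠ : ∀ k x → (k ⊠ x) ^ p ≈ k ⊠ x ^ p
  frobenius-⊠ zero    x = 0^p≈0
  frobenius-⊠ (suc k) x = ≈-trans (frobenius-+ x (k ⊠ x)) (+-congˡ (frobenius-⊠ k x))

  frobenius-∑ : ∀ {k} (f : Fin k → Carrier) → ∑.sum f ^ p ≈ ∑.sum (λ i → f i ^ p)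
  frobenius-∑ {zero}  f = 0^p≈0
  frobenius-∑ {suc k} f = ≈-trans (frobenius-+ (f Fin.zero) (∑.sum (f ∘ Fin.suc))) (+-congˡ (frobenius-∑ (f ∘ Fin.suc)))

  ^-p^suc : ∀ x j → x ^ (p ℕ.^ suc j) ≈ (x ^ (p ℕ.^ j)) ^ p
  ^-p^suc x j = ≈-sym (≈-trans (^-assocʳ x (p ℕ.^ j) p) (≈-reflexive (cong (x ^_) (ℕ.*-comm (p ℕ.^ j) p))))

  -- with 0 replaced by 1, ∏ ζ over F is the product of all units
  ζ : Carrier → Carrier
  ζ y = if does (y ≈? 0#) then 1# else y

  ζ≉0 : ∀ y → ¬ ζ y ≈ 0#
  ζ≉0 y with y ≈? 0#
  ... | yes _  = nontrivial
  ... | no y≉0 = y≉0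

  ζ-cong : ∀ {y z} → y ≈ z → ζ y ≈ ζ z
  ζ-cong {y} {z} y≈z with y ≈? 0# | z ≈? 0#
  ... | yes _   | yes _   = ≈-refl
  ... | no _    | no _    = y≈z
  ... | yes y≈0 | no z≉0  = ⊥-elim (z≉0 (≈-trans (≈-sym y≈z) y≈0))
  ... | no y≉0  | yes z≈0 = ⊥-elim (y≉0 (≈-trans y≈z z≈0))

  module _ {x} (x≉0 : ¬ x ≈ 0#) where

    private
      x⁻¹ : Carrier
      x⁻¹ = proj₁ (inverse x x≉0)

      x*x⁻¹≈1 : x * x⁻¹ ≈ 1#
      x*x⁻¹≈1 = proj₂ (inverse x x≉0)

      -- the factor by which ζ (x * y) falls short of x * ζ y
      defect : Carrier → Carrier
      defect y = if does (y ≈? 0#) then x else 1#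

    x*ζ≈ζ[x*]*defect : ∀ y → x * ζ y ≈ ζ (x * y) * defect y
    x*ζ≈ζ[x*]*defect y with y ≈? 0# | (x * y) ≈? 0#
    ... | yes _   | yes _    = ≈-trans (*-identityʳ x) (≈-sym (*-identityˡ x))
    ... | yes y≈0 | no xy≉0  = ⊥-elim (xy≉0 (≈-trans (*-congˡ y≈0) (zeroʳ x)))
    ... | no y≉0  | yes xy≈0 = ⊥-elim (*-≉0 x≉0 y≉0 xy≈0)
    ... | no _    | no _     = ≈-sym (*-identityʳ (x * y))

    ∏defect≈x : ∏.sum (defect ∘ enum) ≈ x
    ∏defect≈x = ≈-trans (∏-single (defect ∘ enum) (index 0#) off) on
      where
      off : ∀ j → j ≢ index 0# → defect (enum j) ≈ 1#
      off j j≢0 with enum j ≈? 0#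
      ... | yes eⱼ≈0 = ⊥-elim (j≢0 (enum-inj _ _ (≈-trans eⱼ≈0 (≈-sym (enum-index 0#)))))
      ... | no _     = ≈-refl
      on : defect (enum (index 0#)) ≈ x
      on with enum (index 0#) ≈? 0#
      ... | yes _  = ≈-refl
      ... | no e≉0 = ⊥-elim (e≉0 (enum-index 0#))

    x^q*∏ζ≈x*∏ζ : x ^ q * ∏.sum (ζ ∘ enum) ≈ x * ∏.sum (ζ ∘ enum)
    x^q*∏ζ≈x*∏ζ = begin
      x ^ q * P                                              ≈⟨ *-congʳ (∏.sum-replicate q) ⟨
      ∏.sum {q} (λ _ → x) * P                                ≈⟨ ∏.∑-distrib-+ (λ _ → x) (ζ ∘ enum) ⟨
      ∏.sum (λ i → x * ζ (enum i))                           ≈⟨ ∏.sum-cong-≋ (λ i → x*ζ≈ζ[x*]*defect (enum i)) ⟩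
      ∏.sum (λ i → ζ (x * enum i) * defect (enum i))         ≈⟨ ∏.∑-distrib-+ (λ i → ζ (x * enum i)) (defect ∘ enum) ⟩
      ∏.sum (λ i → ζ (x * enum i)) * ∏.sum (defect ∘ enum)   ≈⟨ *-cong (≈-sym (∏-reindex ζ ζ-cong)) ∏defect≈x ⟩
      P * x                                                  ≈⟨ *-comm P x ⟩
      x * P                                                  ∎
      where
      P = ∏.sum (ζ ∘ enum)
      open Reindex (x *_) (x⁻¹ *_) *-congˡ *-congˡ
        (λ y → ≈-trans (≈-sym (*-assoc x x⁻¹ y)) (≈-trans (*-congʳ x*x⁻¹≈1) (*-identityˡ y)))
        (λ y → ≈-trans (≈-sym (*-assoc x⁻¹ x y)) (≈-trans (*-congʳ (≈-trans (*-comm x⁻¹ x) x*x⁻¹≈1)) (*-identityˡ y)))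

  fermat : ∀ x → x ^ q ≈ x
  fermat x with x ≈? 0#
  ... | no x≉0  = *-cancelʳ (x ^ q) x (∏-≉0 (ζ ∘ enum) (ζ≉0 ∘ enum)) (x^q*∏ζ≈x*∏ζ x≉0)
  ... | yes x≈0 = begin
    x ^ q                   ≈⟨ ^-congˡ q x≈0 ⟩
    0# ^ q                  ≡⟨ cong (0# ^_) (sym (ℕ.suc-pred q {{ℕ.m^n≢0 p n}})) ⟩
    0# * 0# ^ ℕ.pred q      ≈⟨ zeroˡ _ ⟩
    0#                      ≈⟨ x≈0 ⟨
    x                       ∎

  module Coordinates (γ : Carrier) where

    β : Fin n → Carrier
    β i = γ ^ (p ℕ.^ toℕ i)

    fromCoords : (Fin n → Fin p) → Carrier
    fromCoords u = ∑.sum (λ i → toℕ (u i) ⊠ β i)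

    fromCoords-cong : ∀ {u v} → (∀ i → u i ≡ v i) → fromCoords u ≈ fromCoords v
    fromCoords-cong u≗v = ∑.sum-cong-≋ (λ i → ≈-reflexive (cong (λ c → toℕ c ⊠ β i) (u≗v i)))

    fromCoords-linear : ∀ {k} (a : Fin k → Fin p) (R : Fin k → Fin n → Fin p) →
      fromCoords (λ i → sumₚ (λ j → a j *ₚ R j i)) ≈ ∑.sum (λ j → toℕ (a j) ⊠ fromCoords (R j))
    fromCoords-linear a R = begin
      ∑.sum (λ i → toℕ (sumₚ (λ j → a j *ₚ R j i)) ⊠ β i)           ≈⟨ ∑.sum-cong-≋ (λ i → toℕ-sumₚ-⊠ (λ j → a j *ₚ R j i) (β i)) ⟩
      ∑.sum (λ i → ∑.sum (λ j → toℕ (a j *ₚ R j i) ⊠ β i))          ≈⟨ ∑.sum-cong-≋ (λ i → ∑.sum-cong-≋ (λ j → toℕ-*ₚ-⊠ (a j) (R j i) (β i))) ⟩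
      ∑.sum (λ i → ∑.sum (λ j → toℕ (a j) ⊠ (toℕ (R j i) ⊠ β i)))   ≈⟨ ∑.∑-comm (λ i j → toℕ (a j) ⊠ (toℕ (R j i) ⊠ β i)) ⟩
      ∑.sum (λ j → ∑.sum (λ i → toℕ (a j) ⊠ (toℕ (R j i) ⊠ β i)))   ≈⟨ ∑.sum-cong-≋ (λ j → ⊠-distrib-∑ (toℕ (a j)) (λ i → toℕ (R j i) ⊠ β i)) ⟨
      ∑.sum (λ j → toℕ (a j) ⊠ fromCoords (R j))                     ∎

    -- the Frobenius map cycles the conjugates γ, γ^p, …, γ^{p^{n-1}}, since γ^{p^n} = γ
    β-frobenius : ∀ i → β i ^ p ≈ β (csuc {p} i)
    β-frobenius i = ≈-trans (≈-sym (^-p^suc γ (toℕ i))) (wrap (toℕ i ℕ.≟ m))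
      where
      wrap : Dec (toℕ i ≡ m) → γ ^ (p ℕ.^ suc (toℕ i)) ≈ β (csuc {p} i)
      wrap (yes i≡m) = begin
        γ ^ (p ℕ.^ suc (toℕ i))   ≡⟨ cong (λ k → γ ^ (p ℕ.^ suc k)) i≡m ⟩
        γ ^ q                     ≈⟨ fermat γ ⟩
        γ                         ≈⟨ *-identityʳ γ ⟨
        γ ^ 1                     ≡⟨ cong (λ k → γ ^ (p ℕ.^ k)) csuc≡0 ⟨
        β (csuc {p} i)            ∎
        where
        csuc≡0 : toℕ (csuc {p} i) ≡ 0
        csuc≡0 = trans (toℕ-csuc {p = p} i) (trans (cong (λ k → suc k % n) i≡m) (n%n≡0 n))
      wrap (no i≢m) = ≈-reflexive (cong (λ k → γ ^ (p ℕ.^ k)) (sym (trans (toℕ-csuc {p = p} i)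
        (m<n⇒m%n≡m (ℕ.s≤s (ℕ.≤∧≢⇒< (ℕ.s≤s⁻¹ (Fin.toℕ<n i)) i≢m))))))

    fromCoords-frobenius : ∀ u → fromCoords u ^ p ≈ fromCoords (u ∘ cpred)
    fromCoords-frobenius u = begin
      fromCoords u ^ p                                          ≈⟨ frobenius-∑ (λ i → toℕ (u i) ⊠ β i) ⟩
      ∑.sum (λ i → (toℕ (u i) ⊠ β i) ^ p)                       ≈⟨ ∑.sum-cong-≋ (λ i → ≈-trans (frobenius-⊠ (toℕ (u i)) (β i)) (×-congʳ (toℕ (u i)) (β-frobenius i))) ⟩
      ∑.sum (λ i → toℕ (u i) ⊠ β (csuc {p} i))                  ≡⟨ ∑.sum-cong-≗ (λ i → cong (λ j → toℕ (u j) ⊠ β (csuc {p} i)) (sym (cpred-csuc {p = p} i))) ⟩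
      ∑.sum (λ i → toℕ (u (cpred (csuc {p} i))) ⊠ β (csuc {p} i)) ≈⟨ ∑.sum-permute (λ j → toℕ (u (cpred j)) ⊠ β j) rotation ⟨
      fromCoords (u ∘ cpred)                                    ∎
      where
      rotation : Permutation n n
      rotation = permutation (csuc {p}) cpred (csuc-cpred {p = p}) (cpred-csuc {p = p})

    frobComb-^p^ : ∀ (v : Vec (Fin p) n) j → frobComb γ v ^ (p ℕ.^ j) ≈ fromCoords (lookup (rot j v))
    frobComb-^p^ v zero    = ≈-trans (*-identityʳ (frobComb γ v)) (frobComb≈ γ v)
    frobComb-^p^ v (suc j) = begin
      frobComb γ v ^ (p ℕ.^ suc j)            ≈⟨ ^-p^suc (frobComb γ v) j ⟩
      (frobComb γ v ^ (p ℕ.^ j)) ^ p          ≈⟨ ^-congˡ p (frobComb-^p^ v j) ⟩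
      fromCoords (lookup (rot j v)) ^ p       ≈⟨ fromCoords-frobenius (lookup (rot j v)) ⟩
      fromCoords (lookup (rot j v) ∘ cpred)   ≈⟨ fromCoords-cong (λ i → sym (lookup-shift (rot j v) i)) ⟩
      fromCoords (lookup (rot (suc j) v))     ∎

    frobComb-frobComb : ∀ (v c : Vec (Fin p) n) → frobComb (frobComb γ v) c ≈ fromCoords (lookup c ᵥ* ⟦ CM v ⟧)
    frobComb-frobComb v c = begin
      frobComb (frobComb γ v) c                                         ≈⟨ frobComb≈ (frobComb γ v) c ⟩
      ∑.sum (λ j → toℕ (lookup c j) ⊠ frobComb γ v ^ (p ℕ.^ toℕ j))     ≈⟨ ∑.sum-cong-≋ (λ j → ×-congʳ (toℕ (lookup c j)) (frobComb-^p^ v (toℕ j))) ⟩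
      ∑.sum (λ j → toℕ (lookup c j) ⊠ fromCoords (lookup (rot (toℕ j) v))) ≈⟨ fromCoords-linear (lookup c) (λ j → lookup (rot (toℕ j) v)) ⟨
      fromCoords (λ i → sumₚ (λ j → lookup c j *ₚ lookup (rot (toℕ j) v) i)) ≈⟨ fromCoords-cong coords ⟩
      fromCoords (lookup c ᵥ* ⟦ CM v ⟧)                                 ∎
      where
      coords : ∀ i → sumₚ (λ j → lookup c j *ₚ lookup (rot (toℕ j) v) i) ≡ (lookup c ᵥ* ⟦ CM v ⟧) i
      coords i = trans (sumₚ≡sum (λ j → lookup c j *ₚ lookup (rot (toℕ j) v) i))
                       (sum-cong-≗ (λ j → cong (lookup c j *ₚ_) (sym (⟦CM⟧ v j i))))

  module _ {γ : Carrier} (γ-normal : Normal n γ) where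

    open Coordinates γ

    fromCoords-surjective : ∀ x → ∃ λ u → fromCoords u ≈ x
    fromCoords-surjective x with proj₁ (γ-normal x)
    ... | c , γc≈x = lookup c , ≈-trans (≈-sym (frobComb≈ γ c)) γc≈x

    fromCoords-injective : ∀ u v → fromCoords u ≈ fromCoords v → ∀ i → u i ≡ v i
    fromCoords-injective u v u≈v i =
      trans (sym (Vec.lookup∘tabulate u i)) (trans (cong (λ c → lookup c i) tabulate-u≡v) (Vec.lookup∘tabulate v i))
      where
      γ-tabulate : ∀ w → frobComb γ (tabulate w) ≈ fromCoords w
      γ-tabulate w = ≈-trans (frobComb≈ γ (tabulate w)) (fromCoords-cong (Vec.lookup∘tabulate w))
      tabulate-u≡v : tabulate u ≡ tabulate v
      tabulate-u≡v = proj₂ (γ-normal (fromCoords u)) (tabulate u) (tabulate v) (γ-tabulate u) (≈-trans (γ-tabulate v) (≈-sym u≈v))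

    normal⇔nonsingular : ∀ (v : Word p n) → Normal n (frobComb γ v) ⇔ Nonsingularᶠ ⟦ CM v ⟧
    normal⇔nonsingular v = mk⇔ to from
      where
      M = ⟦ CM v ⟧
      to : Normal n (frobComb γ v) → Nonsingularᶠ M
      to v-normal = ᵥ*-surjective⇒nonsingular {M = M} λ y →
        let (c , vc≈y) = proj₁ (v-normal (fromCoords y)) in
        lookup c , fromCoords-injective (lookup c ᵥ* M) y (≈-trans (≈-sym (frobComb-frobComb v c)) vc≈y)
      from : Nonsingularᶠ M → Normal n (frobComb γ v)
      from M≢0 x = (tabulate a , va≈x) , unique
        where
        y a : Vector (Fin p) n
        y = proj₁ (fromCoords-surjective x)
        a = proj₁ (nonsingular⇒ᵥ*-surjective {M = M} M≢0 y)
        va≈x : frobComb (frobComb γ v) (tabulate a) ≈ x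
        va≈x = begin
          frobComb (frobComb γ v) (tabulate a)  ≈⟨ frobComb-frobComb v (tabulate a) ⟩
          fromCoords (lookup (tabulate a) ᵥ* M) ≈⟨ fromCoords-cong (λ j → trans (sum-cong-≗ (λ i → cong (_*ₚ M i j) (Vec.lookup∘tabulate a i)))
                                                                              (proj₂ (nonsingular⇒ᵥ*-surjective {M = M} M≢0 y) j)) ⟩
          fromCoords y                          ≈⟨ proj₂ (fromCoords-surjective x) ⟩
          x                                     ∎
        unique : ∀ c d → frobComb (frobComb γ v) c ≈ x → frobComb (frobComb γ v) d ≈ x → c ≡ d
        unique c d vc≈x vd≈x = lookup-ext (nonsingular⇒ᵥ*-injective {M = M} M≢0 (lookup c) (lookup d)
          (fromCoords-injective (lookup c ᵥ* M) (lookup d ᵥ* M)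
            (≈-trans (≈-sym (frobComb-frobComb v c)) (≈-trans vc≈x (≈-trans (≈-sym vd≈x) (frobComb-frobComb v d))))))

  normal-rotations⇔ : ∀ (w : Word p n) {γ} → Normal n γ →
    (∀ v → v ∈[ w ] → Normal n (frobComb γ v)) ⇔ Nonsingularᶠ ⟦ CM w ⟧
  normal-rotations⇔ w γ-normal = mk⇔
    (λ normal → Equivalence.to (normal⇔nonsingular γ-normal w) (normal w (∈[]-refl w)))
    (λ CMw≢0 v v∈[w] → Equivalence.from (normal⇔nonsingular γ-normal v) (nonsingular-∈[] (∈[]-sym v∈[w]) CMw≢0))

theorem16 : (p : ℕ) .{{_ : NonZero p}} → Prime p →
    (n : ℕ) .{{_ : NonZero n}} → (w : Word p n) →
    (F : CommutativeRing 0ℓ 0ℓ) → IsGF p n F →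
    (γ : CommutativeRing.Carrier F) → FieldOps.Normal {p} F n γ →
    let
      S1 = Nonsingular (BWM w)
      S2 = ∀ v → v ∈[ w ] → Invertible (CM v)
      S3 = IsElemRG (CMset w)
      S4 = ∀ v → v ∈[ w ] → FieldOps.Normal {p} F n (FieldOps.frobComb {p} F γ v)
      S5 = ∀ (x : Word p n) →
             (∃ λ (c : Word p n → Fin p) → combo c w ≡ x)
             × (∀ (c d : Word p n → Fin p) → combo c w ≡ x → combo d w ≡ x →
                  ∀ v → v ∈[ w ] → c v ≡ d v)
    in (S1 ⇔ S2) × (S1 ⇔ S3) × (S1 ⇔ S4) × (S1 ⇔ S5)
theorem16 p p-prime (suc m) w F F-isGF γ γ-normal =
  via (invertible-rotations⇔ w) , via (reutenauer⇔ w) , via (normal-rotations⇔ w γ-normal) , via (unique-combination⇔ w)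
  where
  open Determinant p using (⟦_⟧)
  open LinearAlgebra p p-prime using (Nonsingularᶠ)
  open Necklace p p-prime
  open FiniteField p p-prime F m F-isGF using (normal-rotations⇔)
  via : ∀ {S : Set} → S ⇔ Nonsingularᶠ ⟦ CM w ⟧ → Nonsingular (BWM w) ⇔ S
  via S⇔CM = ⇔-sym S⇔CM ⇔-∘ BWM-nonsingular⇔ w
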